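{- For every integer $n>0$, $$\mathfrak B_{2n}+\sum_{\substack{p\ \text{odd prime}\\ (p-1)\mid 2n}}\frac{(-1)^{\,n-\frac{p-1}{2}}}{p}$$ is an integer, where the sum runs over all odd primes $p$ such that $p-1$ divides $2n$.
   Context: The Bernoulli numbers with level $2$, $\mathfrak B_n$, are defined by the power series identity $$\frac{1}{4\sin(x/2)}\log\frac{1+2\sin(x/2)}{1-2\sin(x/2)}=\sum_{n=0}^\infty\mathfrak B_n\frac{x^n}{n!}.$$ Equivalently $\sum_{n\ge0}\mathfrak B_n\frac{x^n}{n!}=\sum_{m\ge0}\frac{(2\sin(x/2))^{2m}}{2m+1}$. -}

module Defs where

open import Data.Nat as ℕ using (ℕ; zero; suc; _∸_; _≟_; _!)
open import Data.Nat.Divisibility using (_∣?_)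
open import Data.Nat.Combinatorics using ()
open import Data.Nat.DivMod using (_/_; _%_)
open import Data.Nat.Primality using (prime?)
open import Data.Integer as ℤ using (ℤ; +_)
open import Data.Rational as ℚ using (ℚ; 0ℚ; 1ℚ; _+_; _*_; -_)
open import Data.Product using (∃-syntax)
open import Relation.Binary.PropositionalEquality using (_≡_)
open import Relation.Nullary using (yes; no)

sumTo : ℕ → (ℕ → ℚ) → ℚ
sumTo zero    f = 0ℚ
sumTo (suc n) f = sumTo n f + f n

signQ : ℕ → ℚ
signQ zero    = 1ℚ
signQ (suc k) = - signQ k

-- the rational number a / d for natural d (taken to be 0 when d = 0)
_/ℕ_ : ℤ → ℕ → ℚ
a /ℕ zero  = 0ℚ
a /ℕ suc d = a ℚ./ suc d

-- Formal power series over ℚ, given by their (ordinary) coefficient sequence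
Series : Set
Series = ℕ → ℚ

_⊛_ : Series → Series → Series
(a ⊛ b) n = sumTo (suc n) (λ i → a i * b (n ∸ i))

_^ˢ_ : Series → ℕ → Series
(a ^ˢ zero) zero    = 1ℚ
(a ^ˢ zero) (suc n) = 0ℚ
(a ^ˢ suc m) = a ⊛ (a ^ˢ m)

-- 2 sin(x/2) = Σ_k (-1)^k x^(2k+1) / (4^k (2k+1)!)
twoSinHalf : Series
twoSinHalf j with j % 2
... | 0 = 0ℚ
... | _ = signQ (j / 2) * ((+ 1) /ℕ (4 ℕ.^ (j / 2) ℕ.* (j !)))

-- Bernoulli numbers of level 2:
--   Σ_n 𝔅 n x^n / n! = Σ_{m ≥ 0} (2 sin(x/2))^(2m) / (2m+1).
-- (2 sin(x/2))^(2m) has order 2m, so only m ≤ n contribute to x^n.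
𝔅 : ℕ → ℚ
𝔅 n = ((+ (n !)) /ℕ 1) *
      sumTo (suc n) (λ m → (twoSinHalf ^ˢ (2 ℕ.* m)) n * ((+ 1) /ℕ (suc (2 ℕ.* m))))

primeTerm : ℕ → ℕ → ℚ
primeTerm n p with prime? p | p % 2 ≟ 1 | (p ∸ 1) ∣? (2 ℕ.* n)
... | yes _ | yes _ | yes _ = signQ (n ∸ ((p ∸ 1) / 2)) * ((+ 1) /ℕ p)
... | _     | _     | _     = 0ℚ

-- Σ over odd primes p with (p-1) ∣ 2n (all such p satisfy p ≤ 2n+1)
primeSum : ℕ → ℚ
primeSum n = sumTo (2 ℕ.* n ℕ.+ 2) (primeTerm n)

IsInteger : ℚ → Set
IsInteger q = ∃[ z ] q ≡ z /ℕ 1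

-- Twisting the coefficients of 2 sin(x/2) by σ j = (-1)^⌊j/2⌋ turns it into
-- 2 sinh(x/2) = e^{x/2} - e^{-x/2}, and (2 sin(x/2))^k differs from (2 sinh(x/2))^k
-- coefficientwise only by the sign σ k σ n.  Since (e^{x/2} - e^{-x/2})^k = e^{-kx/2} (e^x - 1)^k,
-- the n-th exponential coefficient of (2 sinh(x/2))^k is the finite difference Δ^k[X^n] at -k/2.
-- Hence 𝔅_{2n} = Σ_{m ≤ 2n} (-1)^{m+n} Δ^{2m}[X^{2n}](-m) / (2m+1), and Δ^{2m}[X^{2n}](-m) is an
-- integer divisible by (2m)!.  If 2m+1 is composite it divides (2m)!, so the term is an integer.
-- If p = 2m+1 is prime, then C(p-1,j) ≡ (-1)^j mod p, so the numerator is congruent to the complete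
-- power sum Σ_{j<p} j^{2n}, which is ≡ -1 when p-1 ∣ 2n and ≡ 0 otherwise (Fermat, and the Pascal
-- recurrence for power sums); the term (-1)^{n-m}/p of the prime sum cancels exactly that -1.

module Submission where

open import Defs
open import Level using (0ℓ)
open import Algebra.Bundles using (CommutativeRing)
open import Algebra.Bundles.Raw using (RawRing)
open import Algebra.Structures using (IsCommutativeRing)
open import Relation.Binary.PropositionalEquality using (_≡_)
open import Data.Integer using (ℤ)
open import Data.Nat using (ℕ; suc)
open import Data.Nat.Primality using (Prime)

module Factorials where

  open import Data.Nat
  open import Data.Nat.Properties
  open import Data.Nat.Divisibility
  open import Data.Nat.DivMod using (m*[n/m]≡n)
  open import Data.Nat.Primality
  open import Data.Nat.Combinatorics
  open import Data.Nat.Combinatorics.Specification using (nCk≡n!/k![n-k]!)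
  open import Data.Sum using (inj₁; inj₂)
  open import Relation.Binary.PropositionalEquality
  open import Relation.Binary.Definitions using (tri<; tri≈; tri>)
  open import Relation.Nullary using (¬_)
  open import Data.Empty using (⊥-elim)

  nCk*[k!*[n∸k]!]≡n! : ∀ {n k} → k ≤ n → (n C k) * (k ! * (n ∸ k) !) ≡ n !
  nCk*[k!*[n∸k]!]≡n! {n} {k} k≤n = begin
    (n C k) * (k ! * (n ∸ k) !)             ≡⟨ cong (_* (k ! * (n ∸ k) !)) (nCk≡n!/k![n-k]! k≤n) ⟩
    (n ! / (k ! * (n ∸ k) !)) * (k ! * (n ∸ k) !) ≡⟨ *-comm _ (k ! * (n ∸ k) !) ⟩
    (k ! * (n ∸ k) !) * (n ! / (k ! * (n ∸ k) !)) ≡⟨ m*[n/m]≡n (k![n∸k]!∣n! k≤n) ⟩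
    n ! ∎
    where
    open ≡-Reasoning
    instance _ = k !* (n ∸ k) !≢0

  [n+1]Cn≡n+1 : ∀ n → suc n C n ≡ suc n
  [n+1]Cn≡n+1 n = trans (nCk≡nC[n∸k] (n≤1+n n)) (trans (cong (suc n C_) (m+n∸n≡m 1 n)) (nC1≡n (suc n)))

  prime∤m! : ∀ {p} → Prime p → ∀ {m} → m < p → ¬ (p ∣ m !)
  prime∤m! {p} pp {zero} _ p∣1 = ¬prime[1] (subst Prime (∣1⇒≡1 p∣1) pp)
  prime∤m! {p} pp {suc m} m<p p∣ with euclidsLemma (suc m) (m !) pp p∣
  ... | inj₁ p∣m+1 = <⇒≱ m<p (∣⇒≤ p∣m+1)
  ... | inj₂ p∣m! = prime∤m! pp (<-trans (n<1+n m) m<p) p∣m!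

  prime∣pCk : ∀ {p} → Prime p → ∀ {k} → 0 < k → k < p → p ∣ p C k
  prime∣pCk {p@(suc p-1)} pp {k} 0<k k<p
    with euclidsLemma (p C k) (k ! * (p ∸ k) !) pp p∣product
    where
    p∣product : p ∣ (p C k) * (k ! * (p ∸ k) !)
    p∣product = subst (p ∣_) (sym (nCk*[k!*[n∸k]!]≡n! (<⇒≤ k<p))) (m∣m*n (p-1 !))
  ... | inj₁ p∣pCk = p∣pCk
  ... | inj₂ p∣product with euclidsLemma (k !) ((p ∸ k) !) pp p∣product
  ...   | inj₁ p∣k! = ⊥-elim (prime∤m! pp k<p p∣k!)
  ...   | inj₂ p∣[p∸k]! = ⊥-elim (prime∤m! pp (∸-monoʳ-< {p} {k} {0} 0<k (<⇒≤ k<p)) p∣[p∸k]!)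

  n∣n! : ∀ {n} → 0 < n → n ∣ n !
  n∣n! {suc n} _ = m∣m*n (n !)

  m*n∣n! : ∀ {m n} → 0 < m → m < n → m * n ∣ n !
  m*n∣n! {m} {suc n} 0<m (s≤s m≤n) =
    subst (_∣ suc n !) (*-comm (suc n) m) (*-pres-∣ (∣-refl {suc n}) (∣-trans (n∣n! 0<m) (m≤n⇒m!∣n! m≤n)))

  composite∣[n∸1]! : ∀ {q} → Composite q → q ≢ 4 → q ∣ (q ∸ 1) !
  composite∣[n∸1]! {q} (composite {d} d<q (divides e q≡e*d)) q≢4 with <-cmp d e
  ... | tri< d<e _ _ = subst (_∣ (q ∸ 1) !) (sym (trans q≡e*d (*-comm e d)))
                         (∣-trans (m*n∣n! 0<d d<e) (m≤n⇒m!∣n! (<⇒≤pred e<q)))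
    where
    0<d : 0 < d
    0<d = <-trans z<s (nonTrivial⇒n>1 d)
    e<q : e < q
    e<q = subst (e <_) (sym q≡e*d) (m<m*n e d {{>-nonZero (<-trans 0<d d<e)}} (nonTrivial⇒n>1 d))
  ... | tri> _ _ e<d = subst (_∣ (q ∸ 1) !) (sym q≡e*d)
                         (∣-trans (m*n∣n! 0<e e<d) (m≤n⇒m!∣n! (<⇒≤pred d<q)))
    where
    0<e : 0 < e
    0<e = n≢0⇒n>0 {e} (λ { refl → n≮0 {d} (subst (d <_) q≡e*d d<q) })
  -- For q = d * d, the hypothesis q ≢ 4 forces d ≥ 3, so d and 2 * d are distinct factors of (q ∸ 1)!.
  ... | tri≈ _ refl _ = subst (_∣ (q ∸ 1) !) (sym q≡e*d)
                          (∣-trans (*-monoʳ-∣ d (n∣m*n 2)) (∣-trans (m*n∣n! 0<d d<2d) (m≤n⇒m!∣n! (<⇒≤pred 2d<q))))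
    where
    2≤d : 2 ≤ d
    2≤d = nonTrivial⇒n>1 d
    0<d : 0 < d
    0<d = <-trans z<s 2≤d
    d<2d : d < 2 * d
    d<2d = subst (d <_) (*-comm d 2) (m<m*n d 2 {{>-nonZero 0<d}} (s≤s (s≤s z≤n)))
    3≤d : 3 ≤ d
    3≤d = ≤∧≢⇒< 2≤d (λ 2≡d → q≢4 (trans q≡e*d (cong (λ x → x * x) (sym 2≡d))))
    2d<q : 2 * d < q
    2d<q = begin-strict
      2 * d <⟨ *-monoˡ-< d {{>-nonZero 0<d}} {2} {3} (s≤s (s≤s (s≤s z≤n))) ⟩
      3 * d ≤⟨ *-monoˡ-≤ d 3≤d ⟩
      d * d ≡⟨ sym q≡e*d ⟩
      q ∎
      where open ≤-Reasoning

module RingSums (R : RawRing 0ℓ 0ℓ)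
  (isCR : IsCommutativeRing _≡_ (RawRing._+_ R) (RawRing._*_ R) (RawRing.-_ R) (RawRing.0# R) (RawRing.1# R)) where

  open RawRing R using (Carrier; _+_; _*_; -_; 0#; 1#)

  open import Data.Nat as ℕ using (ℕ; zero; suc; _∸_; _<_; _≤_)
  import Data.Nat.Properties as ℕ
  open import Data.Nat.Combinatorics using (_C_; nCn≡1; nCk+nC[k+1]≡[n+1]C[k+1])
  open import Data.Nat.Combinatorics.Specification using (k>n⇒nCk≡0)
  open import Data.Fin using (toℕ)
  import Algebra.Properties.CommutativeSemigroup
  open import Relation.Binary.PropositionalEquality

  commutativeRing : CommutativeRing 0ℓ 0ℓ
  commutativeRing = record { isCommutativeRing = isCR }

  open CommutativeRing commutativeRing using
    (+-assoc; +-comm; +-identityˡ; +-identityʳ; -‿inverseˡ; -‿inverseʳ;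
     *-assoc; *-identityˡ; *-identityʳ; distribˡ; distribʳ; zeroˡ; zeroʳ; _-_)
  open import Algebra.Properties.Ring (CommutativeRing.ring commutativeRing) using
    (-‿involutive; -0#≈0#; -‿+-comm; -‿distribˡ-*; -‿distribʳ-*; x[y-z]≈xy-xz)
  open import Algebra.Properties.CommutativeSemiring.Exp (CommutativeRing.commutativeSemiring commutativeRing) public using
    (_^_; ^-homo-*; ^-assocʳ; ^-distrib-*)
  open import Algebra.Properties.Semiring.Mult (CommutativeRing.semiring commutativeRing) using
    (_×_; ×-homo-+; ×-assoc-*)
  import Algebra.Properties.CommutativeSemiring.Binomial (CommutativeRing.commutativeSemiring commutativeRing) as Binomial
  open import Algebra.Properties.Monoid.Sum (CommutativeRing.+-monoid commutativeRing) using (sum)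
  module +-Props = Algebra.Properties.CommutativeSemigroup (CommutativeRing.+-commutativeSemigroup commutativeRing)
  module *-Props = Algebra.Properties.CommutativeSemigroup (CommutativeRing.*-commutativeSemigroup commutativeRing)
  open ≡-Reasoning

  fromℕ : ℕ → Carrier
  fromℕ n = n × 1#

  fromℕ-+ : ∀ m n → fromℕ (m ℕ.+ n) ≡ fromℕ m + fromℕ n
  fromℕ-+ m n = ×-homo-+ 1# m n

  sign : ℕ → Carrier
  sign zero    = 1#
  sign (suc n) = - sign n

  ∑ : ℕ → (ℕ → Carrier) → Carrier
  ∑ zero    f = 0#
  ∑ (suc n) f = ∑ n f + f n

  ∑-cong< : ∀ n {f g : ℕ → Carrier} → (∀ i → i < n → f i ≡ g i) → ∑ n f ≡ ∑ n g
  ∑-cong< zero    f≡g = refl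
  ∑-cong< (suc n) f≡g = cong₂ _+_ (∑-cong< n (λ i i<n → f≡g i (ℕ.m<n⇒m<1+n i<n))) (f≡g n ℕ.≤-refl)

  ∑-cong : ∀ n {f g : ℕ → Carrier} → (∀ i → f i ≡ g i) → ∑ n f ≡ ∑ n g
  ∑-cong n f≡g = ∑-cong< n (λ i _ → f≡g i)

  ∑-zero : ∀ n (f : ℕ → Carrier) → (∀ i → i < n → f i ≡ 0#) → ∑ n f ≡ 0#
  ∑-zero n f f≡0 = trans (∑-cong< n f≡0) (∑-zero′ n)
    where
    ∑-zero′ : ∀ n → ∑ n (λ _ → 0#) ≡ 0#
    ∑-zero′ zero    = refl
    ∑-zero′ (suc n) = trans (+-identityʳ _) (∑-zero′ n)

  ∑-distrib-+ : ∀ n (f g : ℕ → Carrier) → ∑ n (λ i → f i + g i) ≡ ∑ n f + ∑ n g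
  ∑-distrib-+ zero    f g = sym (+-identityʳ 0#)
  ∑-distrib-+ (suc n) f g = begin
    ∑ n (λ i → f i + g i) + (f n + g n) ≡⟨ cong (_+ (f n + g n)) (∑-distrib-+ n f g) ⟩
    (∑ n f + ∑ n g) + (f n + g n)       ≡⟨ +-Props.interchange (∑ n f) (∑ n g) (f n) (g n) ⟩
    (∑ n f + f n) + (∑ n g + g n)       ∎

  -‿∑ : ∀ n (f : ℕ → Carrier) → - ∑ n f ≡ ∑ n (λ i → - f i)
  -‿∑ zero    f = -0#≈0#
  -‿∑ (suc n) f = trans (sym (-‿+-comm (∑ n f) (f n))) (cong (_+ - f n) (-‿∑ n f))

  ∑[f-g]≡∑f-∑g : ∀ n (f g : ℕ → Carrier) → ∑ n (λ i → f i - g i) ≡ ∑ n f - ∑ n g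
  ∑[f-g]≡∑f-∑g n f g = trans (∑-distrib-+ n f (λ i → - g i)) (cong (∑ n f +_) (sym (-‿∑ n g)))

  *-distribˡ-∑ : ∀ n c (f : ℕ → Carrier) → c * ∑ n f ≡ ∑ n (λ i → c * f i)
  *-distribˡ-∑ zero    c f = zeroʳ c
  *-distribˡ-∑ (suc n) c f = trans (distribˡ c (∑ n f) (f n)) (cong (_+ c * f n) (*-distribˡ-∑ n c f))

  ∑-head : ∀ n (f : ℕ → Carrier) → ∑ (suc n) f ≡ f 0 + ∑ n (λ i → f (suc i))
  ∑-head zero    f = trans (+-identityˡ (f 0)) (sym (+-identityʳ (f 0)))
  ∑-head (suc n) f = trans (cong (_+ f (suc n)) (∑-head n f)) (+-assoc (f 0) _ _)

  ∑-last-zero : ∀ n (f : ℕ → Carrier) → f n ≡ 0# → ∑ (suc n) f ≡ ∑ n f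
  ∑-last-zero n f fn≡0 = trans (cong (∑ n f +_) fn≡0) (+-identityʳ _)

  ∑-comm : ∀ m n (f : ℕ → ℕ → Carrier) → ∑ m (λ j → ∑ n (λ i → f i j)) ≡ ∑ n (λ i → ∑ m (λ j → f i j))
  ∑-comm zero    n f = sym (∑-zero n (λ _ → 0#) (λ _ _ → refl))
  ∑-comm (suc m) n f = trans (cong (_+ ∑ n (λ i → f i m)) (∑-comm m n f))
                             (sym (∑-distrib-+ n (λ i → ∑ m (λ j → f i j)) (λ i → f i m)))

  ∑-telescope : ∀ n (f : ℕ → Carrier) → ∑ n (λ j → f (suc j) - f j) ≡ f n - f 0
  ∑-telescope zero    f = sym (-‿inverseʳ (f 0))
  ∑-telescope (suc n) f = begin
    ∑ n (λ j → f (suc j) - f j) + (f (suc n) - f n) ≡⟨ cong (_+ (f (suc n) - f n)) (∑-telescope n f) ⟩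
    (f n - f 0) + (f (suc n) - f n)                 ≡⟨ +-comm _ _ ⟩
    (f (suc n) - f n) + (f n - f 0)                 ≡⟨ +-assoc (f (suc n)) _ _ ⟩
    f (suc n) + (- f n + (f n - f 0))               ≡⟨ cong (f (suc n) +_) (sym (+-assoc (- f n) (f n) _)) ⟩
    f (suc n) + ((- f n + f n) - f 0)               ≡⟨ cong (λ z → f (suc n) + (z - f 0)) (-‿inverseˡ (f n)) ⟩
    f (suc n) + (0# - f 0)                          ≡⟨ cong (f (suc n) +_) (+-identityˡ _) ⟩
    f (suc n) - f 0                                 ∎

  ∑-const-1 : ∀ n → ∑ n (λ _ → 1#) ≡ fromℕ n
  ∑-const-1 zero    = refl
  ∑-const-1 (suc n) = trans (cong (_+ 1#) (∑-const-1 n)) (+-comm (fromℕ n) 1#)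

  ∑-pairs : ∀ n (f : ℕ → Carrier) → ∑ (2 ℕ.* n) f ≡ ∑ n (λ i → f (2 ℕ.* i) + f (suc (2 ℕ.* i)))
  ∑-pairs zero    f = refl
  ∑-pairs (suc n) f = begin
    ∑ (2 ℕ.* suc n) f                                 ≡⟨ cong (λ m → ∑ m f) (ℕ.*-suc 2 n) ⟩
    ∑ (2 ℕ.* n) f + f (2 ℕ.* n) + f (suc (2 ℕ.* n))   ≡⟨ +-assoc _ _ _ ⟩
    ∑ (2 ℕ.* n) f + (f (2 ℕ.* n) + f (suc (2 ℕ.* n))) ≡⟨ cong (_+ _) (∑-pairs n f) ⟩
    ∑ (suc n) (λ i → f (2 ℕ.* i) + f (suc (2 ℕ.* i))) ∎

  ∑-extend : ∀ m k (f : ℕ → Carrier) → (∀ i → m ≤ i → f i ≡ 0#) → ∑ (m ℕ.+ k) f ≡ ∑ m f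
  ∑-extend m zero    f f≡0 = cong (λ n → ∑ n f) (ℕ.+-identityʳ m)
  ∑-extend m (suc k) f f≡0 = begin
    ∑ (m ℕ.+ suc k) f           ≡⟨ cong (λ n → ∑ n f) (ℕ.+-suc m k) ⟩
    ∑ (m ℕ.+ k) f + f (m ℕ.+ k) ≡⟨ cong₂ _+_ (∑-extend m k f f≡0) (f≡0 _ (ℕ.m≤m+n m k)) ⟩
    ∑ m f + 0#                  ≡⟨ +-identityʳ _ ⟩
    ∑ m f                       ∎

  sum≡∑ : ∀ n (f : ℕ → Carrier) → sum {n} (λ i → f (toℕ i)) ≡ ∑ n f
  sum≡∑ zero    f = refl
  sum≡∑ (suc n) f = trans (cong (f 0 +_) (sum≡∑ n (λ i → f (suc i)))) (sym (∑-head n f))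

  sign-+ : ∀ m n → sign (m ℕ.+ n) ≡ sign m * sign n
  sign-+ zero    n = sym (*-identityˡ (sign n))
  sign-+ (suc m) n = trans (cong -_ (sign-+ m n)) (-‿distribˡ-* (sign m) (sign n))

  -x*-y≡x*y : ∀ x y → - x * - y ≡ x * y
  -x*-y≡x*y x y = begin
    - x * - y     ≡⟨ sym (-‿distribˡ-* x (- y)) ⟩
    - (x * - y)   ≡⟨ cong -_ (sym (-‿distribʳ-* x y)) ⟩
    - - (x * y)   ≡⟨ -‿involutive _ ⟩
    x * y         ∎

  sign*sign≡1 : ∀ n → sign n * sign n ≡ 1#
  sign*sign≡1 zero    = *-identityˡ 1#
  sign*sign≡1 (suc n) = trans (-x*-y≡x*y (sign n) (sign n)) (sign*sign≡1 n)

  sign[2n]≡1 : ∀ n → sign (2 ℕ.* n) ≡ 1#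
  sign[2n]≡1 n = begin
    sign (n ℕ.+ (n ℕ.+ 0)) ≡⟨ cong (λ m → sign (n ℕ.+ m)) (ℕ.+-identityʳ n) ⟩
    sign (n ℕ.+ n)         ≡⟨ sign-+ n n ⟩
    sign n * sign n        ≡⟨ sign*sign≡1 n ⟩
    1#                     ∎

  sign[m∸n]≡sign[m]*sign[n] : ∀ {m n} → n ℕ.≤ m → sign (m ∸ n) ≡ sign m * sign n
  sign[m∸n]≡sign[m]*sign[n] {m} {n} n≤m = begin
    sign (m ∸ n)                   ≡⟨ sym (*-identityʳ _) ⟩
    sign (m ∸ n) * 1#              ≡⟨ cong (sign (m ∸ n) *_) (sym (sign*sign≡1 n)) ⟩
    sign (m ∸ n) * (sign n * sign n) ≡⟨ sym (*-assoc _ _ _) ⟩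
    sign (m ∸ n) * sign n * sign n ≡⟨ cong (_* sign n) (sym (sign-+ (m ∸ n) n)) ⟩
    sign (m ∸ n ℕ.+ n) * sign n    ≡⟨ cong (λ k → sign k * sign n) (ℕ.m∸n+n≡m n≤m) ⟩
    sign m * sign n                ∎

  [-x]^n≡sign[n]*x^n : ∀ x n → (- x) ^ n ≡ sign n * x ^ n
  [-x]^n≡sign[n]*x^n x zero    = sym (*-identityʳ 1#)
  [-x]^n≡sign[n]*x^n x (suc n) = begin
    - x * (- x) ^ n        ≡⟨ cong (- x *_) ([-x]^n≡sign[n]*x^n x n) ⟩
    - x * (sign n * x ^ n) ≡⟨ sym (-‿distribˡ-* x _) ⟩
    - (x * (sign n * x ^ n)) ≡⟨ cong -_ (*-Props.x∙yz≈y∙xz x (sign n) (x ^ n)) ⟩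
    - (sign n * (x * x ^ n)) ≡⟨ -‿distribˡ-* (sign n) _ ⟩
    - sign n * (x * x ^ n)   ∎

  1^n≡1 : ∀ n → 1# ^ n ≡ 1#
  1^n≡1 zero    = refl
  1^n≡1 (suc n) = trans (*-identityˡ _) (1^n≡1 n)

  binomial : ∀ x a n → ∑ (suc n) (λ i → fromℕ (n C i) * (a ^ i * x ^ (n ∸ i))) ≡ (x + a) ^ n
  binomial x a n = begin
    ∑ (suc n) (λ i → fromℕ (n C i) * (a ^ i * x ^ (n ∸ i))) ≡⟨ ∑-cong (suc n) (λ i → ×-assoc-* (n C i) 1# _) ⟩
    ∑ (suc n) (λ i → (n C i) × (1# * (a ^ i * x ^ (n ∸ i)))) ≡⟨ ∑-cong (suc n) (λ i → cong ((n C i) ×_) (*-identityˡ _)) ⟩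
    ∑ (suc n) (λ i → (n C i) × (a ^ i * x ^ (n ∸ i)))        ≡⟨ sym (sum≡∑ (suc n) _) ⟩
    Binomial.binomialExpansion a x n                          ≡⟨ sym (Binomial.theorem n a x) ⟩
    (a + x) ^ n                                               ≡⟨ cong (_^ n) (+-comm a x) ⟩
    (x + a) ^ n                                               ∎

  powerSum : ℕ → ℕ → Carrier
  powerSum m r = ∑ m (λ j → fromℕ j ^ r)

  ∑binomial*powerSum : ∀ m r → ∑ (suc r) (λ i → fromℕ (suc r C i) * powerSum m i) ≡ fromℕ m ^ suc r
  ∑binomial*powerSum m r = begin
    ∑ (suc r) (λ i → fromℕ (suc r C i) * powerSum m i)
      ≡⟨ ∑-cong (suc r) (λ i → *-distribˡ-∑ m (fromℕ (suc r C i)) (λ j → fromℕ j ^ i)) ⟩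
    ∑ (suc r) (λ i → ∑ m (λ j → fromℕ (suc r C i) * fromℕ j ^ i))
      ≡⟨ sym (∑-comm m (suc r) (λ i j → fromℕ (suc r C i) * fromℕ j ^ i)) ⟩
    ∑ m (λ j → ∑ (suc r) (λ i → fromℕ (suc r C i) * fromℕ j ^ i))
      ≡⟨ ∑-cong m binomial-difference ⟩
    ∑ m (λ j → fromℕ (suc j) ^ suc r - fromℕ j ^ suc r)
      ≡⟨ ∑-telescope m (λ j → fromℕ j ^ suc r) ⟩
    fromℕ m ^ suc r - 0# * 0# ^ r
      ≡⟨ cong (λ z → fromℕ m ^ suc r - z) (zeroˡ _) ⟩
    fromℕ m ^ suc r - 0#
      ≡⟨ trans (cong (fromℕ m ^ suc r +_) -0#≈0#) (+-identityʳ _) ⟩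
    fromℕ m ^ suc r ∎
    where
    term : ℕ → ℕ → Carrier
    term j i = fromℕ (suc r C i) * (fromℕ j ^ i * 1# ^ (suc r ∸ i))
    binomial-difference : ∀ j → ∑ (suc r) (λ i → fromℕ (suc r C i) * fromℕ j ^ i)
                                ≡ fromℕ (suc j) ^ suc r - fromℕ j ^ suc r
    binomial-difference j = begin
      ∑ (suc r) (λ i → fromℕ (suc r C i) * fromℕ j ^ i)
        ≡⟨ ∑-cong (suc r) (λ i → cong (fromℕ (suc r C i) *_) (sym (trans (cong (fromℕ j ^ i *_) (1^n≡1 (suc r ∸ i))) (*-identityʳ _)))) ⟩
      ∑ (suc r) (term j)
        ≡⟨ sym (trans (+-assoc _ _ _) (trans (cong (∑ (suc r) (term j) +_) (-‿inverseʳ _)) (+-identityʳ _))) ⟩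
      ∑ (suc r) (term j) + term j (suc r) - term j (suc r)
        ≡⟨ cong₂ _-_ (binomial 1# (fromℕ j) (suc r)) top-term ⟩
      fromℕ (suc j) ^ suc r - fromℕ j ^ suc r ∎
      where
      top-term : term j (suc r) ≡ fromℕ j ^ suc r
      top-term = begin
        fromℕ (suc r C suc r) * (fromℕ j ^ suc r * 1# ^ (r ∸ r))
          ≡⟨ cong₂ (λ c e → fromℕ c * (fromℕ j ^ suc r * 1# ^ e)) (nCn≡1 (suc r)) (ℕ.n∸n≡0 r) ⟩
        (1# + 0#) * (fromℕ j ^ suc r * 1#)
          ≡⟨ cong₂ _*_ (+-identityʳ 1#) (*-identityʳ _) ⟩
        1# * fromℕ j ^ suc r
          ≡⟨ *-identityˡ _ ⟩
        fromℕ j ^ suc r ∎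

  Δ : ℕ → ℕ → Carrier → Carrier
  Δ zero    n x = x ^ n
  Δ (suc k) n x = Δ k n (x + 1#) - Δ k n x

  Δ[X^0]≡0 : ∀ k x → Δ (suc k) 0 x ≡ 0#
  Δ[X^0]≡0 zero    x = -‿inverseʳ 1#
  Δ[X^0]≡0 (suc k) x = trans (cong₂ _-_ (Δ[X^0]≡0 k (x + 1#)) (Δ[X^0]≡0 k x)) (-‿inverseʳ 0#)

  Δ-binomial : ∀ k n x a → ∑ (suc n) (λ i → fromℕ (n C i) * (a ^ i * Δ k (n ∸ i) x)) ≡ Δ k n (x + a)
  Δ-binomial zero    n x a = binomial x a n
  Δ-binomial (suc k) n x a = begin
    ∑ (suc n) (λ i → b i * (a ^ i * (Δ k (n ∸ i) (x + 1#) - Δ k (n ∸ i) x)))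
      ≡⟨ ∑-cong (suc n) (λ i → trans (cong (b i *_) (x[y-z]≈xy-xz (a ^ i) _ _)) (x[y-z]≈xy-xz (b i) _ _)) ⟩
    ∑ (suc n) (λ i → b i * (a ^ i * Δ k (n ∸ i) (x + 1#)) - b i * (a ^ i * Δ k (n ∸ i) x))
      ≡⟨ ∑[f-g]≡∑f-∑g (suc n) _ _ ⟩
    _ - _
      ≡⟨ cong₂ _-_ (Δ-binomial k n (x + 1#) a) (Δ-binomial k n x a) ⟩
    Δ k n (x + 1# + a) - Δ k n (x + a)
      ≡⟨ cong (λ y → Δ k n y - Δ k n (x + a)) (+-Props.xy∙z≈xz∙y x 1# a) ⟩
    Δ k n (x + a + 1#) - Δ k n (x + a) ∎
    where
    b : ℕ → Carrier
    b i = fromℕ (n C i)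

  module _ (n : ℕ) where

    alternatingTerm : ℕ → Carrier → ℕ → Carrier
    alternatingTerm k x j = sign (k ∸ j) * (fromℕ (k C j) * (x + fromℕ j) ^ n)

    private
      pascal-split : ∀ k x j → alternatingTerm (suc k) x (suc j)
                     ≡ alternatingTerm k (x + 1#) j + sign (k ∸ j) * (fromℕ (k C suc j) * (x + fromℕ (suc j)) ^ n)
      pascal-split k x j = begin
        sign (k ∸ j) * (fromℕ (suc k C suc j) * y ^ n)
          ≡⟨ cong (λ c → sign (k ∸ j) * (fromℕ c * y ^ n)) (sym (nCk+nC[k+1]≡[n+1]C[k+1] k j)) ⟩
        sign (k ∸ j) * (fromℕ (k C j ℕ.+ k C suc j) * y ^ n)
          ≡⟨ cong (λ c → sign (k ∸ j) * (c * y ^ n)) (fromℕ-+ (k C j) (k C suc j)) ⟩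
        sign (k ∸ j) * ((fromℕ (k C j) + fromℕ (k C suc j)) * y ^ n)
          ≡⟨ trans (cong (sign (k ∸ j) *_) (distribʳ _ _ _)) (distribˡ _ _ _) ⟩
        sign (k ∸ j) * (fromℕ (k C j) * y ^ n) + sign (k ∸ j) * (fromℕ (k C suc j) * y ^ n)
          ≡⟨ cong (λ z → sign (k ∸ j) * (fromℕ (k C j) * z ^ n) + sign (k ∸ j) * (fromℕ (k C suc j) * y ^ n)) (sym (+-assoc x 1# (fromℕ j))) ⟩
        alternatingTerm k (x + 1#) j + sign (k ∸ j) * (fromℕ (k C suc j) * y ^ n) ∎
        where
        y = x + fromℕ (suc j)

      alternating-step : ∀ k x → ∑ (suc (suc k)) (alternatingTerm (suc k) x)
                         ≡ ∑ (suc k) (alternatingTerm k (x + 1#)) - ∑ (suc k) (alternatingTerm k x)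
      alternating-step k x = begin
        ∑ (suc (suc k)) (alternatingTerm (suc k) x)
          ≡⟨ ∑-head (suc k) _ ⟩
        alternatingTerm (suc k) x 0 + ∑ (suc k) (λ j → alternatingTerm (suc k) x (suc j))
          ≡⟨ cong₂ _+_ (sym (-‿distribˡ-* (sign k) _)) (∑-cong (suc k) (pascal-split k x)) ⟩
        - t 0 + ∑ (suc k) (λ j → alternatingTerm k (x + 1#) j + b j)
          ≡⟨ cong (- t 0 +_) (∑-distrib-+ (suc k) _ b) ⟩
        - t 0 + (∑ (suc k) (alternatingTerm k (x + 1#)) + ∑ (suc k) b)
          ≡⟨ cong (λ z → - t 0 + (∑ (suc k) (alternatingTerm k (x + 1#)) + z)) b-sum ⟩
        - t 0 + (∑ (suc k) (alternatingTerm k (x + 1#)) + - ∑ k (λ j → t (suc j)))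
          ≡⟨ +-Props.x∙yz≈y∙xz (- t 0) _ _ ⟩
        ∑ (suc k) (alternatingTerm k (x + 1#)) + (- t 0 + - ∑ k (λ j → t (suc j)))
          ≡⟨ cong (∑ (suc k) (alternatingTerm k (x + 1#)) +_) (-‿+-comm (t 0) _) ⟩
        ∑ (suc k) (alternatingTerm k (x + 1#)) - (t 0 + ∑ k (λ j → t (suc j)))
          ≡⟨ cong (λ z → ∑ (suc k) (alternatingTerm k (x + 1#)) - z) (sym (∑-head k t)) ⟩
        ∑ (suc k) (alternatingTerm k (x + 1#)) - ∑ (suc k) t ∎
        where
        t : ℕ → Carrier
        t = alternatingTerm k x
        b : ℕ → Carrier
        b j = sign (k ∸ j) * (fromℕ (k C suc j) * (x + fromℕ (suc j)) ^ n)
        b-sum : ∑ (suc k) b ≡ - ∑ k (λ j → t (suc j))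
        b-sum = begin
          ∑ (suc k) b                  ≡⟨ ∑-last-zero k b (trans (cong (λ c → sign (k ∸ k) * (fromℕ c * (x + fromℕ (suc k)) ^ n)) (k>n⇒nCk≡0 (ℕ.n<1+n k)))
                                                              (trans (cong (sign (k ∸ k) *_) (zeroˡ _)) (zeroʳ _))) ⟩
          ∑ k b                        ≡⟨ ∑-cong< k (λ j j<k → trans (cong (λ m → sign m * (fromℕ (k C suc j) * (x + fromℕ (suc j)) ^ n)) (ℕ.+-∸-assoc 1 j<k)) (sym (-‿distribˡ-* _ _))) ⟩
          ∑ k (λ j → - t (suc j))      ≡⟨ sym (-‿∑ k _) ⟩
          - ∑ k (λ j → t (suc j))      ∎

    Δ≡∑alternatingTerm : ∀ k x → Δ k n x ≡ ∑ (suc k) (alternatingTerm k x)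
    Δ≡∑alternatingTerm zero    x = sym (begin
      0# + 1# * ((1# + 0#) * (x + 0#) ^ n) ≡⟨ trans (+-identityˡ _) (*-identityˡ _) ⟩
      (1# + 0#) * (x + 0#) ^ n             ≡⟨ cong₂ (λ c y → c * y ^ n) (+-identityʳ 1#) (+-identityʳ x) ⟩
      1# * x ^ n                           ≡⟨ *-identityˡ _ ⟩
      x ^ n                                ∎)
    Δ≡∑alternatingTerm (suc k) x = trans (cong₂ _-_ (Δ≡∑alternatingTerm k (x + 1#)) (Δ≡∑alternatingTerm k x)) (sym (alternating-step k x))

module IntegerDifferences where

  open import Data.Nat as ℕ using (ℕ; zero; suc; _!)
  open import Data.Integer using (ℤ; +_; _+_; _*_; -_; _-_)
  import Data.Integer.Properties as ℤ
  open import Data.Integer.Divisibility.Signed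
  open import Data.Integer.Tactic.RingSolver using (solve-∀)
  open import Relation.Binary.PropositionalEquality

  open RingSums (CommutativeRing.rawRing ℤ.+-*-commutativeRing) ℤ.+-*-isCommutativeRing public

  fromℕ≡+ : ∀ n → fromℕ n ≡ + n
  fromℕ≡+ zero    = refl
  fromℕ≡+ (suc n) = cong (λ m → + 1 + m) (fromℕ≡+ n)

  Δ[X^n+1] : ∀ k n x → Δ (suc k) (suc n) x ≡ x * Δ (suc k) n x + + suc k * Δ k n (x + + 1)
  Δ[X^n+1] zero    n x = regroup x ((x + + 1) ^ n) (x ^ n)
    where
    regroup : ∀ x y z → (x + + 1) * y - x * z ≡ x * (y - z) + + 1 * y
    regroup = solve-∀
  Δ[X^n+1] (suc k) n x = begin
    Δ (suc k) (suc n) (x + + 1) - Δ (suc k) (suc n) x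
      ≡⟨ cong₂ _-_ (Δ[X^n+1] k n (x + + 1)) (Δ[X^n+1] k n x) ⟩
    ((x + + 1) * Δ (suc k) n (x + + 1) + + suc k * Δ k n (x + + 1 + + 1))
      - (x * Δ (suc k) n x + + suc k * Δ k n (x + + 1))
      ≡⟨ regroup x (Δ (suc k) n x) (Δ k n (x + + 1 + + 1)) (Δ k n (x + + 1)) (+ suc k) ⟩
    x * Δ (suc (suc k)) n x + + suc (suc k) * Δ (suc k) n (x + + 1) ∎
    where
    open ≡-Reasoning
    regroup : ∀ x d e₂ e₁ c → ((x + + 1) * (e₂ - e₁) + c * e₂) - (x * d + c * e₁)
                             ≡ x * ((e₂ - e₁) - d) + (+ 1 + c) * (e₂ - e₁)
    regroup = solve-∀

  k!∣Δ : ∀ k n x → + (k !) ∣ Δ k n x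
  k!∣Δ zero    n       x = divides (Δ 0 n x) (sym (ℤ.*-identityʳ _))
  k!∣Δ (suc k) zero    x = subst (+ (suc k !) ∣_) (sym (Δ[X^0]≡0 k x)) (divides (+ 0) refl)
  k!∣Δ (suc k) (suc n) x = subst (+ (suc k !) ∣_) (sym (Δ[X^n+1] k n x))
    (∣m∣n⇒∣m+n (∣n⇒∣m*n x (k!∣Δ (suc k) n x))
               (subst (_∣ + suc k * Δ k n (x + + 1)) (sym (ℤ.pos-* (suc k) (k !))) (*-monoʳ-∣ (+ suc k) (k!∣Δ k n (x + + 1)))))

module Congruence (P : ℤ) where

  open import Data.Nat using (ℕ; zero; suc; _<_)
  import Data.Nat.Properties as ℕ
  open import Data.Integer using (ℤ; +_; _+_; _*_; -_; _-_)
  open import Data.Integer.Divisibility.Signed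
  open import Data.Integer.Tactic.RingSolver using (solve-∀)
  open import Relation.Binary.PropositionalEquality using (_≡_; refl; sym; subst)
  open import Relation.Binary.Bundles using (Setoid)
  import Relation.Binary.Reasoning.Setoid
  import Data.Integer.Properties as ℤ
  open IntegerDifferences using (_^_; ∑; ∑-zero)

  infix 4 _≈_
  record _≈_ (a b : ℤ) : Set where
    constructor mod
    field P∣a-b : P ∣ a - b
  open _≈_ public

  ≈-refl : ∀ {a} → a ≈ a
  ≈-refl {a} = mod (subst (P ∣_) (sym (a-a≡0 a)) (divides (+ 0) refl))
    where
    a-a≡0 : ∀ a → a - a ≡ + 0
    a-a≡0 = solve-∀

  ≈-sym : ∀ {a b} → a ≈ b → b ≈ a
  ≈-sym {a} {b} (mod P∣a-b) = mod (subst (P ∣_) (b-a≡-[a-b] a b) (∣m⇒∣-m P∣a-b))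
    where
    b-a≡-[a-b] : ∀ a b → - (a - b) ≡ b - a
    b-a≡-[a-b] = solve-∀

  ≈-trans : ∀ {a b c} → a ≈ b → b ≈ c → a ≈ c
  ≈-trans {a} {b} {c} (mod P∣a-b) (mod P∣b-c) = mod (subst (P ∣_) (telescope a b c) (∣m∣n⇒∣m+n P∣a-b P∣b-c))
    where
    telescope : ∀ a b c → (a - b) + (b - c) ≡ a - c
    telescope = solve-∀

  ≈-setoid : Setoid 0ℓ 0ℓ
  ≈-setoid = record { Carrier = ℤ ; _≈_ = _≈_ ; isEquivalence = record { refl = ≈-refl ; sym = ≈-sym ; trans = ≈-trans } }

  module ≈-Reasoning = Relation.Binary.Reasoning.Setoid ≈-setoid

  ≡⇒≈ : ∀ {a b} → a ≡ b → a ≈ b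
  ≡⇒≈ refl = ≈-refl

  +-cong : ∀ {a b c d} → a ≈ b → c ≈ d → a + c ≈ b + d
  +-cong {a} {b} {c} {d} (mod P∣a-b) (mod P∣c-d) = mod (subst (P ∣_) (regroup a b c d) (∣m∣n⇒∣m+n P∣a-b P∣c-d))
    where
    regroup : ∀ a b c d → (a - b) + (c - d) ≡ (a + c) - (b + d)
    regroup = solve-∀

  -‿cong : ∀ {a b} → a ≈ b → - a ≈ - b
  -‿cong {a} {b} (mod P∣a-b) = mod (subst (P ∣_) (regroup a b) (∣m⇒∣-m P∣a-b))
    where
    regroup : ∀ a b → - (a - b) ≡ - a - - b
    regroup = solve-∀

  *-cong : ∀ {a b c d} → a ≈ b → c ≈ d → a * c ≈ b * d
  *-cong {a} {b} {c} {d} (mod P∣a-b) (mod P∣c-d) = mod (subst (P ∣_) (regroup a b c d) (∣m∣n⇒∣m+n (∣n⇒∣m*n a P∣c-d) (∣m⇒∣m*n d P∣a-b)))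
    where
    regroup : ∀ a b c d → a * (c - d) + (a - b) * d ≡ a * c - b * d
    regroup = solve-∀

  ^-cong : ∀ {a b} n → a ≈ b → a ^ n ≈ b ^ n
  ^-cong zero    a≈b = ≈-refl
  ^-cong (suc n) a≈b = *-cong a≈b (^-cong n a≈b)

  ∑-cong≈ : ∀ n {f g : ℕ → ℤ} → (∀ i → i < n → f i ≈ g i) → ∑ n f ≈ ∑ n g
  ∑-cong≈ zero    f≈g = ≈-refl
  ∑-cong≈ (suc n) f≈g = +-cong (∑-cong≈ n (λ i i<n → f≈g i (ℕ.m<n⇒m<1+n i<n))) (f≈g n ℕ.≤-refl)

  ∑≈0 : ∀ n (f : ℕ → ℤ) → (∀ i → i < n → f i ≈ + 0) → ∑ n f ≈ + 0
  ∑≈0 n f f≈0 = ≈-trans (∑-cong≈ n f≈0) (≡⇒≈ (∑-zero n (λ _ → + 0) (λ _ _ → refl)))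

  *-zeroʳ-≈ : ∀ c {a} → a ≈ + 0 → c * a ≈ + 0
  *-zeroʳ-≈ c a≈0 = ≈-trans (*-cong (≈-refl {c}) a≈0) (≡⇒≈ (ℤ.*-zeroʳ c))

  +-cancelˡ-≈0 : ∀ {a b} → a + b ≈ + 0 → a ≈ + 0 → b ≈ + 0
  +-cancelˡ-≈0 {a} {b} a+b≈0 a≈0 = begin
    b              ≡⟨ regroup a b ⟩
    (a + b) - a    ≈⟨ +-cong a+b≈0 (-‿cong a≈0) ⟩
    + 0 - + 0      ≡⟨⟩
    + 0            ∎
    where
    open ≈-Reasoning
    regroup : ∀ a b → b ≡ (a + b) - a
    regroup = solve-∀

  a+b≈0⇒b≈-a : ∀ {a b} → a + b ≈ + 0 → b ≈ - a
  a+b≈0⇒b≈-a {a} {b} (mod P∣a+b-0) = mod (subst (P ∣_) (regroup a b) P∣a+b-0)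
    where
    regroup : ∀ a b → a + b - + 0 ≡ b - - a
    regroup = solve-∀

  private
    a-0≡a : ∀ a → a - + 0 ≡ a
    a-0≡a = solve-∀

  ∣⇒≈0 : ∀ {a} → P ∣ a → a ≈ + 0
  ∣⇒≈0 {a} P∣a = mod (subst (P ∣_) (sym (a-0≡a a)) P∣a)

  ≈0⇒∣ : ∀ {a} → a ≈ + 0 → P ∣ a
  ≈0⇒∣ {a} (mod P∣a-0) = subst (P ∣_) (a-0≡a a) P∣a-0

module PrimeModulus (p-2 : ℕ) (p-prime : Prime (suc (suc p-2))) where

  open import Data.Nat as ℕ using (ℕ; zero; suc; _∸_; _<_; _≤_; s≤s; z<s)
  import Data.Nat.Properties as ℕ
  import Data.Nat.Divisibility as ℕ
  open import Data.Nat.DivMod using (_%_; _/_; m≡m%n+[m/n]*n; m%n<n)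
  open import Data.Nat.Combinatorics using (_C_; nCn≡1; nCk+nC[k+1]≡[n+1]C[k+1])
  open import Data.Nat.Induction using (<-rec)
  open import Data.Nat.Primality using (euclidsLemma)
  open import Data.Integer using (ℤ; +_; _+_; _*_; -_; _-_; ∣_∣)
  import Data.Integer.Properties as ℤ
  open import Data.Integer.Divisibility.Signed
  open import Data.Integer.Tactic.RingSolver using (solve-∀)
  open import Data.Sum using (inj₁; inj₂)
  open import Data.Empty using (⊥-elim)
  open import Relation.Nullary using (¬_)
  open import Relation.Binary.PropositionalEquality using (_≡_; refl; sym; trans; cong; cong₂; subst)
  open Factorials using (prime∣pCk; [n+1]Cn≡n+1)
  open IntegerDifferences
  open Congruence (+ suc (suc p-2))

  p p-1 : ℕ
  p   = suc (suc p-2)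
  p-1 = suc p-2

  fromℕ[p]≈0 : fromℕ p ≈ + 0
  fromℕ[p]≈0 = ∣⇒≈0 (subst (+ p ∣_) (sym (fromℕ≡+ p)) ∣-refl)

  fromℕ[pCk]≈0 : ∀ {k} → 0 < k → k < p → fromℕ (p C k) ≈ + 0
  fromℕ[pCk]≈0 0<k k<p = ∣⇒≈0 (subst (+ p ∣_) (sym (fromℕ≡+ _)) (∣ᵤ⇒∣ (prime∣pCk p-prime 0<k k<p)))

  *-cancelˡ-≈0 : ∀ {n a} → 0 < n → n < p → fromℕ n * a ≈ + 0 → a ≈ + 0
  *-cancelˡ-≈0 {n} {a} 0<n n<p na≈0 with euclidsLemma n ∣ a ∣ p-prime p∣n∣a∣
    where
    p∣n∣a∣ : p ℕ.∣ n ℕ.* ∣ a ∣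
    p∣n∣a∣ = subst (p ℕ.∣_) (ℤ.abs-* (+ n) a) (∣⇒∣ᵤ (subst (λ c → + p ∣ c * a) (fromℕ≡+ n) (≈0⇒∣ na≈0)))
  ... | inj₁ p∣n = ⊥-elim (ℕ.<⇒≱ n<p (ℕ.∣⇒≤ {{ℕ.>-nonZero 0<n}} p∣n))
  ... | inj₂ p∣a = ∣⇒≈0 (∣ᵤ⇒∣ p∣a)

  fermat : ∀ a → fromℕ a ^ p ≈ fromℕ a
  fermat zero    = ≈-refl
  fermat (suc a) = begin
    fromℕ (suc a) ^ p                      ≡⟨ cong (_^ p) (ℤ.+-comm (+ 1) (fromℕ a)) ⟩
    (fromℕ a + + 1) ^ p                    ≡⟨ sym (binomial (fromℕ a) (+ 1) p) ⟩
    ∑ (suc p) t                            ≡⟨ ∑-head p t ⟩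
    t 0 + (∑ p-1 (λ i → t (suc i)) + t p)  ≈⟨ +-cong (≡⇒≈ t₀) (+-cong (∑≈0 p-1 (λ i → t (suc i)) tᵢ≈0) tₚ) ⟩
    fromℕ a ^ p + (+ 0 + + 1)              ≈⟨ +-cong (fermat a) ≈-refl ⟩
    fromℕ a + + 1                          ≡⟨ ℤ.+-comm (fromℕ a) (+ 1) ⟩
    fromℕ (suc a)                          ∎
    where
    open ≈-Reasoning
    t : ℕ → ℤ
    t i = fromℕ (p C i) * ((+ 1) ^ i * fromℕ a ^ (p ∸ i))
    t₀ : t 0 ≡ fromℕ a ^ p
    t₀ = trans (ℤ.*-identityˡ _) (ℤ.*-identityˡ _)
    tₚ : t p ≈ + 1
    tₚ = begin
      fromℕ (p C p) * ((+ 1) ^ p * fromℕ a ^ (p ∸ p)) ≡⟨ cong₂ (λ c e → fromℕ c * ((+ 1) ^ p * fromℕ a ^ e)) (nCn≡1 p) (ℕ.n∸n≡0 p) ⟩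
      + 1 * ((+ 1) ^ p * + 1)                          ≡⟨ trans (ℤ.*-identityˡ _) (trans (ℤ.*-identityʳ _) (1^n≡1 p)) ⟩
      + 1                                            ∎
    tᵢ≈0 : ∀ i → i < p-1 → t (suc i) ≈ + 0
    tᵢ≈0 i i<p-1 = ≈-trans (*-cong (fromℕ[pCk]≈0 z<s (s≤s i<p-1)) ≈-refl) (≡⇒≈ refl)

  fermat-little : ∀ {j} → 0 < j → j < p → fromℕ j ^ p-1 ≈ + 1
  fermat-little {j} 0<j j<p = mod (≈0⇒∣ (*-cancelˡ-≈0 0<j j<p (mod (subst (+ p ∣_) (factor (fromℕ j) (fromℕ j ^ p-1)) (P∣a-b (fermat j))))))
    where
    factor : ∀ x y → x * y - x ≡ x * (y - + 1) - + 0
    factor = solve-∀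

  ^-reduce : ∀ {j} → 0 < j → j < p → ∀ r q → fromℕ j ^ (r ℕ.+ q ℕ.* p-1) ≈ fromℕ j ^ r
  ^-reduce {j} 0<j j<p r q = begin
    fromℕ j ^ (r ℕ.+ q ℕ.* p-1)          ≡⟨ ^-homo-* (fromℕ j) r (q ℕ.* p-1) ⟩
    fromℕ j ^ r * fromℕ j ^ (q ℕ.* p-1)  ≡⟨ cong (λ e → fromℕ j ^ r * fromℕ j ^ e) (ℕ.*-comm q p-1) ⟩
    fromℕ j ^ r * fromℕ j ^ (p-1 ℕ.* q)  ≡⟨ cong (fromℕ j ^ r *_) (sym (^-assocʳ (fromℕ j) p-1 q)) ⟩
    fromℕ j ^ r * (fromℕ j ^ p-1) ^ q    ≈⟨ *-cong (≈-refl {fromℕ j ^ r}) (^-cong q (fermat-little 0<j j<p)) ⟩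
    fromℕ j ^ r * (+ 1) ^ q              ≡⟨ trans (cong (fromℕ j ^ r *_) (1^n≡1 q)) (ℤ.*-identityʳ _) ⟩
    fromℕ j ^ r                          ∎
    where open ≈-Reasoning

  powerSum≡∑[1+j]^r : ∀ {r} → 0 < r → powerSum p r ≡ ∑ p-1 (λ j → fromℕ (suc j) ^ r)
  powerSum≡∑[1+j]^r {suc r} _ = trans (∑-head p-1 (λ j → fromℕ j ^ suc r)) (ℤ.+-identityˡ _)

  powerSum-reduce : ∀ r q → 0 < r → powerSum p (r ℕ.+ q ℕ.* p-1) ≈ powerSum p r
  powerSum-reduce r q 0<r = begin
    powerSum p (r ℕ.+ q ℕ.* p-1)                      ≡⟨ powerSum≡∑[1+j]^r (ℕ.<-≤-trans 0<r (ℕ.m≤m+n r _)) ⟩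
    ∑ p-1 (λ j → fromℕ (suc j) ^ (r ℕ.+ q ℕ.* p-1))   ≈⟨ ∑-cong≈ p-1 (λ j j<p-1 → ^-reduce z<s (s≤s j<p-1) r q) ⟩
    ∑ p-1 (λ j → fromℕ (suc j) ^ r)                   ≡⟨ sym (powerSum≡∑[1+j]^r 0<r) ⟩
    powerSum p r                                      ∎
    where open ≈-Reasoning

  powerSum[0]≈0 : powerSum p 0 ≈ + 0
  powerSum[0]≈0 = ≈-trans (≡⇒≈ (∑-const-1 p)) fromℕ[p]≈0

  powerSum≈0-below : ∀ r → suc r < p-1 → powerSum p (suc r) ≈ + 0
  powerSum≈0-below = <-rec _ step
    where
    step : ∀ r → (∀ {i} → i < r → suc i < p-1 → powerSum p (suc i) ≈ + 0) → suc r < p-1 → powerSum p (suc r) ≈ + 0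
    step r below r+1<p-1 = *-cancelˡ-≈0 z<s (s≤s r+1<p-1) (+-cancelˡ-≈0 whole≈0 initial≈0)
      where
      g : ℕ → ℤ
      g i = fromℕ (suc (suc r) C i) * powerSum p i
      whole≈0 : ∑ (suc r) g + fromℕ (suc (suc r)) * powerSum p (suc r) ≈ + 0
      whole≈0 = begin
        ∑ (suc r) g + fromℕ (suc (suc r)) * powerSum p (suc r) ≡⟨ cong (λ c → ∑ (suc r) g + fromℕ c * powerSum p (suc r)) (sym ([n+1]Cn≡n+1 (suc r))) ⟩
        ∑ (suc (suc r)) g                                       ≡⟨ ∑binomial*powerSum p (suc r) ⟩
        fromℕ p ^ suc (suc r)                                   ≈⟨ ^-cong (suc (suc r)) fromℕ[p]≈0 ⟩
        + 0                                                     ∎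
        where open ≈-Reasoning
      initial≈0 : ∑ (suc r) g ≈ + 0
      initial≈0 = begin
        ∑ (suc r) g                     ≡⟨ ∑-head r g ⟩
        g 0 + ∑ r (λ i → g (suc i))     ≈⟨ +-cong (*-zeroʳ-≈ (fromℕ (suc (suc r) C 0)) powerSum[0]≈0)
                                                  (∑≈0 r (λ i → g (suc i)) (λ i i<r → *-zeroʳ-≈ (fromℕ (suc (suc r) C suc i)) (below i<r (ℕ.<-trans (s≤s i<r) r+1<p-1)))) ⟩
        + 0                             ∎
        where open ≈-Reasoning

  powerSum≈-1 : ∀ {r} → p-1 ℕ.∣ r → 0 < r → powerSum p r ≈ - + 1
  powerSum≈-1 {r} (ℕ.divides q refl) 0<r = begin
    powerSum p (q ℕ.* p-1)                           ≡⟨ powerSum≡∑[1+j]^r 0<r ⟩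
    ∑ p-1 (λ j → fromℕ (suc j) ^ (0 ℕ.+ q ℕ.* p-1)) ≈⟨ ∑-cong≈ p-1 (λ j j<p-1 → ^-reduce z<s (s≤s j<p-1) 0 q) ⟩
    ∑ p-1 (λ _ → + 1)                   ≡⟨ ∑-const-1 p-1 ⟩
    fromℕ p-1                           ≈⟨ mod (subst (+ p ∣_) (regroup (fromℕ p-1)) (P∣a-b fromℕ[p]≈0)) ⟩
    - + 1                               ∎
    where
    open ≈-Reasoning
    regroup : ∀ a → + 1 + a - + 0 ≡ a - - + 1
    regroup = solve-∀

  powerSum≈0 : ∀ {r} → ¬ (p-1 ℕ.∣ r) → powerSum p r ≈ + 0
  powerSum≈0 {r} p-1∤r with r % p-1 in r%p-1≡s
  ... | zero  = ⊥-elim (p-1∤r (ℕ.m%n≡0⇒n∣m r p-1 r%p-1≡s))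
  ... | suc s = begin
    powerSum p r                          ≡⟨ cong (powerSum p) (trans (m≡m%n+[m/n]*n r p-1) (cong (ℕ._+ r / p-1 ℕ.* p-1) r%p-1≡s)) ⟩
    powerSum p (suc s ℕ.+ r / p-1 ℕ.* p-1) ≈⟨ powerSum-reduce (suc s) (r / p-1) z<s ⟩
    powerSum p (suc s)                    ≈⟨ powerSum≈0-below s (subst (_< p-1) r%p-1≡s (m%n<n r p-1)) ⟩
    + 0                                   ∎
    where open ≈-Reasoning

  sign*binomial≈1 : ∀ {j} → j ≤ p-1 → sign j * fromℕ (p-1 C j) ≈ + 1
  sign*binomial≈1 {zero}  _       = ≈-refl
  sign*binomial≈1 {suc j} j+1≤p-1 = begin
    - sign j * fromℕ (p-1 C suc j)        ≡⟨ neg-swap (sign j) _ ⟩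
    sign j * - fromℕ (p-1 C suc j)        ≈⟨ *-cong (≈-refl {sign j}) (-‿cong pascal) ⟩
    sign j * - - fromℕ (p-1 C j)          ≡⟨ cong (sign j *_) (ℤ.neg-involutive _) ⟩
    sign j * fromℕ (p-1 C j)              ≈⟨ sign*binomial≈1 (ℕ.≤-trans (ℕ.n≤1+n j) j+1≤p-1) ⟩
    + 1                                   ∎
    where
    open ≈-Reasoning
    neg-swap : ∀ s c → - s * c ≡ s * - c
    neg-swap = solve-∀
    pascal : fromℕ (p-1 C suc j) ≈ - fromℕ (p-1 C j)
    pascal = a+b≈0⇒b≈-a (begin
      fromℕ (p-1 C j) + fromℕ (p-1 C suc j) ≡⟨ sym (fromℕ-+ (p-1 C j) _) ⟩
      fromℕ (p-1 C j ℕ.+ p-1 C suc j)       ≡⟨ cong fromℕ (nCk+nC[k+1]≡[n+1]C[k+1] p-1 j) ⟩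
      fromℕ (p C suc j)                     ≈⟨ fromℕ[pCk]≈0 z<s (s≤s j+1≤p-1) ⟩
      + 0                                   ∎)

  private
    shiftedPowerSum : ℕ → ℤ → ℤ
    shiftedPowerSum n x = ∑ p (λ j → (x + fromℕ j) ^ n)

    shiftedPowerSum-step : ∀ n x → shiftedPowerSum n (x + + 1) ≈ shiftedPowerSum n x
    shiftedPowerSum-step n x = begin
      shiftedPowerSum n (x + + 1)           ≡⟨ ∑-cong p (λ j → cong (_^ n) (ℤ.+-assoc x (+ 1) (fromℕ j))) ⟩
      ∑ p (λ j → f (suc j))                 ≡⟨ regroup (f 0) _ ⟩
      (f 0 + ∑ p (λ j → f (suc j))) - f 0   ≡⟨ cong (_- f 0) (sym (∑-head p f)) ⟩
      (shiftedPowerSum n x + f p) - f 0     ≈⟨ +-cong (+-cong (≈-refl {shiftedPowerSum n x}) (^-cong n (+-cong (≈-refl {x}) fromℕ[p]≈0))) ≈-refl ⟩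
      (shiftedPowerSum n x + f 0) - f 0     ≡⟨ regroup′ (shiftedPowerSum n x) (f 0) ⟩
      shiftedPowerSum n x                   ∎
      where
      open ≈-Reasoning
      f : ℕ → ℤ
      f j = (x + fromℕ j) ^ n
      regroup : ∀ a b → b ≡ (a + b) - a
      regroup = solve-∀
      regroup′ : ∀ a b → (a + b) - b ≡ a
      regroup′ = solve-∀

    shiftedPowerSum≈powerSum : ∀ n m → shiftedPowerSum n (- + m) ≈ powerSum p n
    shiftedPowerSum≈powerSum n zero    = ≡⇒≈ (∑-cong p (λ j → cong (_^ n) (ℤ.+-identityˡ (fromℕ j))))
    shiftedPowerSum≈powerSum n (suc m) = ≈-trans (≈-sym (subst (λ y → shiftedPowerSum n y ≈ shiftedPowerSum n (- + suc m)) (regroup (+ m)) (shiftedPowerSum-step n (- + suc m)))) (shiftedPowerSum≈powerSum n m)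
      where
      regroup : ∀ y → - (+ 1 + y) + + 1 ≡ - y
      regroup = solve-∀

  Δ[p-1]≈powerSum : sign p-1 ≡ + 1 → ∀ n m → Δ p-1 n (- + m) ≈ powerSum p n
  Δ[p-1]≈powerSum sign[p-1]≡1 n m = begin
    Δ p-1 n x                            ≡⟨ Δ≡∑alternatingTerm n p-1 x ⟩
    ∑ p (alternatingTerm n p-1 x)        ≈⟨ ∑-cong≈ p (λ j j<p → term≈ j (ℕ.≤-pred j<p)) ⟩
    shiftedPowerSum n x                  ≈⟨ shiftedPowerSum≈powerSum n m ⟩
    powerSum p n                         ∎
    where
    open ≈-Reasoning
    x = - + m
    term≈ : ∀ j → j ≤ p-1 → alternatingTerm n p-1 x j ≈ (x + fromℕ j) ^ n
    term≈ j j≤p-1 = begin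
      sign (p-1 ∸ j) * (fromℕ (p-1 C j) * y)        ≡⟨ cong (_* (fromℕ (p-1 C j) * y)) (sign[m∸n]≡sign[m]*sign[n] j≤p-1) ⟩
      sign p-1 * sign j * (fromℕ (p-1 C j) * y)     ≡⟨ cong (λ s → s * sign j * (fromℕ (p-1 C j) * y)) sign[p-1]≡1 ⟩
      + 1 * sign j * (fromℕ (p-1 C j) * y)          ≡⟨ regroup (sign j) (fromℕ (p-1 C j)) y ⟩
      sign j * fromℕ (p-1 C j) * y                  ≈⟨ *-cong (sign*binomial≈1 j≤p-1) (≈-refl {y}) ⟩
      + 1 * y                                       ≡⟨ ℤ.*-identityˡ y ⟩
      y                                             ∎
      where
      y = (x + fromℕ j) ^ n
      regroup : ∀ s c y → + 1 * s * (c * y) ≡ s * c * y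
      regroup = solve-∀

module RationalEmbedding where

  open import Data.Nat as ℕ using (ℕ; zero; suc; _<_)
  open import Data.Integer as ℤ using (ℤ; +_)
  open import Data.Integer.Tactic.RingSolver using (solve-∀)
  open import Data.Rational as ℚ using (ℚ; 1ℚ; toℚᵘ)
  import Data.Rational.Properties as ℚ
  open import Data.Rational.Unnormalised as ℚᵘ using (mkℚᵘ; _≃_; *≡*)
  import Data.Rational.Unnormalised.Properties as ℚᵘ
  open import Relation.Binary.PropositionalEquality
  module ℤ-Sums = IntegerDifferences
  open RingSums (CommutativeRing.rawRing ℚ.+-*-commutativeRing) ℚ.+-*-isCommutativeRing public

  ι : ℤ → ℚ
  ι z = z /ℕ 1

  private
    toℚᵘ[i/d+1]≃mkℚᵘ : ∀ i d → toℚᵘ (i ℚ./ suc d) ≃ mkℚᵘ i d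
    toℚᵘ[i/d+1]≃mkℚᵘ i d = ℚ.toℚᵘ-fromℚᵘ (mkℚᵘ i d)

  ι-+ : ∀ a b → ι (a ℤ.+ b) ≡ ι a ℚ.+ ι b
  ι-+ a b = ℚ.toℚᵘ-injective (ℚᵘ.≃-trans (toℚᵘ[i/d+1]≃mkℚᵘ (a ℤ.+ b) 0) (ℚᵘ.≃-sym
    (ℚᵘ.≃-trans (ℚ.toℚᵘ-homo-+ (ι a) (ι b)) (ℚᵘ.≃-trans (ℚᵘ.+-cong (toℚᵘ[i/d+1]≃mkℚᵘ a 0) (toℚᵘ[i/d+1]≃mkℚᵘ b 0)) (*≡* (cross a b))))))
    where
    cross : ∀ a b → (a ℤ.* + 1 ℤ.+ b ℤ.* + 1) ℤ.* + 1 ≡ (a ℤ.+ b) ℤ.* + 1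
    cross = solve-∀

  ι-* : ∀ a b → ι (a ℤ.* b) ≡ ι a ℚ.* ι b
  ι-* a b = ℚ.toℚᵘ-injective (ℚᵘ.≃-trans (toℚᵘ[i/d+1]≃mkℚᵘ (a ℤ.* b) 0) (ℚᵘ.≃-sym
    (ℚᵘ.≃-trans (ℚ.toℚᵘ-homo-* (ι a) (ι b)) (ℚᵘ.*-cong (toℚᵘ[i/d+1]≃mkℚᵘ a 0) (toℚᵘ[i/d+1]≃mkℚᵘ b 0)))))

  ι-neg : ∀ a → ι (ℤ.- a) ≡ ℚ.- ι a
  ι-neg a = ℚ.toℚᵘ-injective (ℚᵘ.≃-trans (toℚᵘ[i/d+1]≃mkℚᵘ (ℤ.- a) 0) (ℚᵘ.≃-sym
    (ℚᵘ.≃-trans (ℚ.toℚᵘ-homo‿- (ι a)) (ℚᵘ.-‿cong (toℚᵘ[i/d+1]≃mkℚᵘ a 0)))))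

  ι[n]*[1/n]≡1 : ∀ n → 0 < n → ι (+ n) ℚ.* ((+ 1) /ℕ n) ≡ 1ℚ
  ι[n]*[1/n]≡1 (suc d) _ = ℚ.toℚᵘ-injective (ℚᵘ.≃-trans (ℚ.toℚᵘ-homo-* (ι (+ suc d)) ((+ 1) /ℕ suc d))
    (ℚᵘ.≃-trans (ℚᵘ.*-cong (toℚᵘ[i/d+1]≃mkℚᵘ (+ suc d) 0) (toℚᵘ[i/d+1]≃mkℚᵘ (+ 1) d)) (*≡* (cross (+ suc d)))))
    where
    cross : ∀ a → (a ℤ.* + 1) ℤ.* + 1 ≡ + 1 ℤ.* (+ 1 ℤ.* a)
    cross = solve-∀

  ι-fromℕ : ∀ n → ι (ℤ-Sums.fromℕ n) ≡ fromℕ n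
  ι-fromℕ zero    = refl
  ι-fromℕ (suc n) = trans (ι-+ (+ 1) (ℤ-Sums.fromℕ n)) (cong (1ℚ ℚ.+_) (ι-fromℕ n))

  ι-^ : ∀ x n → ι (x ℤ-Sums.^ n) ≡ ι x ^ n
  ι-^ x zero    = refl
  ι-^ x (suc n) = trans (ι-* x (x ℤ-Sums.^ n)) (cong (ι x ℚ.*_) (ι-^ x n))

  ι-sign : ∀ n → ι (ℤ-Sums.sign n) ≡ sign n
  ι-sign zero    = refl
  ι-sign (suc n) = trans (ι-neg (ℤ-Sums.sign n)) (cong ℚ.-_ (ι-sign n))

  ι-Δ : ∀ k n x → ι (ℤ-Sums.Δ k n x) ≡ Δ k n (ι x)
  ι-Δ zero    n x = ι-^ x n
  ι-Δ (suc k) n x = begin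
    ι (ℤ-Sums.Δ k n (x ℤ.+ + 1) ℤ.- ℤ-Sums.Δ k n x)              ≡⟨ ι-+ (ℤ-Sums.Δ k n (x ℤ.+ + 1)) (ℤ.- ℤ-Sums.Δ k n x) ⟩
    ι (ℤ-Sums.Δ k n (x ℤ.+ + 1)) ℚ.+ ι (ℤ.- ℤ-Sums.Δ k n x)       ≡⟨ cong₂ ℚ._+_ (ι-Δ k n (x ℤ.+ + 1)) (ι-neg (ℤ-Sums.Δ k n x)) ⟩
    Δ k n (ι (x ℤ.+ + 1)) ℚ.- ι (ℤ-Sums.Δ k n x)                  ≡⟨ cong₂ (λ a b → Δ k n a ℚ.- b) (ι-+ x (+ 1)) (ι-Δ k n x) ⟩
    Δ k n (ι x ℚ.+ 1ℚ) ℚ.- Δ k n (ι x)                            ∎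
    where open ≡-Reasoning

  signQ≡sign : ∀ n → signQ n ≡ sign n
  signQ≡sign zero    = refl
  signQ≡sign (suc n) = cong ℚ.-_ (signQ≡sign n)

  sumTo≡∑ : ∀ n f → sumTo n f ≡ ∑ n f
  sumTo≡∑ zero    f = refl
  sumTo≡∑ (suc n) f = cong (ℚ._+ f n) (sumTo≡∑ n f)

module Series where

  open import Data.Nat as ℕ using (ℕ; zero; suc; _∸_; _<_; _≤_; _!; ⌊_/2⌋)
  import Data.Nat.Properties as ℕ
  open import Data.Nat.Combinatorics using (_C_)
  open import Data.Nat.DivMod using (_%_; _/_; [m+kn]%n≡m%n; m*n%n≡0; +-distrib-/; m*n/n≡m)
  open import Data.Parity.Base as ℙ using (0ℙ; 1ℙ)
  import Data.Parity.Properties as ℙ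
  open import Data.Integer as ℤ using (ℤ; +_)
  import Data.Integer.Properties as ℤ
  open import Data.Rational as ℚ using (ℚ; 0ℚ; 1ℚ; ½)
  import Data.Rational.Properties as ℚ
  open import Data.Empty using (⊥-elim)
  open import Relation.Nullary using (yes; no)
  open import Relation.Binary.PropositionalEquality
  open RationalEmbedding
  open import Data.Rational.Solver using (module +-*-Solver)
  open +-*-Solver using (solve; _:+_; _:-_; _:*_; :-_; _:=_; con)

  data EvenOdd : ℕ → Set where
    even : ∀ a → EvenOdd (2 ℕ.* a)
    odd  : ∀ a → EvenOdd (suc (2 ℕ.* a))

  evenOdd : ∀ n → EvenOdd n
  evenOdd zero          = even 0
  evenOdd (suc zero)    = odd 0
  evenOdd (suc (suc n)) with evenOdd n
  ... | even a = subst EvenOdd (ℕ.*-suc 2 a) (even (suc a))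
  ... | odd a  = subst EvenOdd (cong suc (ℕ.*-suc 2 a)) (odd (suc a))

  ⌊2a/2⌋≡a : ∀ a → ⌊ 2 ℕ.* a /2⌋ ≡ a
  ⌊2a/2⌋≡a a = sym (trans (ℕ.n≡⌊n+n/2⌋ a) (cong ⌊_/2⌋ (cong (a ℕ.+_) (sym (ℕ.+-identityʳ a)))))

  ⌊[2a+r]/2⌋≡a+⌊r/2⌋ : ∀ a r → ⌊ 2 ℕ.* a ℕ.+ r /2⌋ ≡ a ℕ.+ ⌊ r /2⌋
  ⌊[2a+r]/2⌋≡a+⌊r/2⌋ zero    r = refl
  ⌊[2a+r]/2⌋≡a+⌊r/2⌋ (suc a) r = begin
    ⌊ 2 ℕ.* suc a ℕ.+ r /2⌋       ≡⟨ cong (λ m → ⌊ m ℕ.+ r /2⌋) (ℕ.*-suc 2 a) ⟩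
    ⌊ 2 ℕ.+ 2 ℕ.* a ℕ.+ r /2⌋     ≡⟨ cong suc (⌊[2a+r]/2⌋≡a+⌊r/2⌋ a r) ⟩
    suc a ℕ.+ ⌊ r /2⌋             ∎
    where open ≡-Reasoning

  [2a]%2≡0 : ∀ a → (2 ℕ.* a) % 2 ≡ 0
  [2a]%2≡0 a = trans (cong (_% 2) (ℕ.*-comm 2 a)) (m*n%n≡0 a 2)

  [1+2a]%2≡1 : ∀ a → suc (2 ℕ.* a) % 2 ≡ 1
  [1+2a]%2≡1 a = trans (cong (λ m → suc m % 2) (ℕ.*-comm 2 a)) ([m+kn]%n≡m%n 1 a 2)

  [1+2a]/2≡a : ∀ a → suc (2 ℕ.* a) / 2 ≡ a
  [1+2a]/2≡a a = trans (cong (λ m → suc m / 2) (ℕ.*-comm 2 a))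
    (trans (+-distrib-/ 1 (a ℕ.* 2) (subst (λ r → 1 ℕ.+ r < 2) (sym (m*n%n≡0 a 2)) ℕ.≤-refl)) (m*n/n≡m a 2))

  twoSinHalf-even : ∀ a → twoSinHalf (2 ℕ.* a) ≡ 0ℚ
  twoSinHalf-even a rewrite [2a]%2≡0 a = refl

  twoSinHalf-odd : ∀ a → twoSinHalf (suc (2 ℕ.* a)) ≡ signQ a ℚ.* ((+ 1) /ℕ (4 ℕ.^ a ℕ.* suc (2 ℕ.* a) !))
  twoSinHalf-odd a rewrite [1+2a]%2≡1 a | [1+2a]/2≡a a = refl

  σ : ℕ → ℚ
  σ j = sign ⌊ j /2⌋

  σ[2a]≡sign[a] : ∀ a → σ (2 ℕ.* a) ≡ sign a
  σ[2a]≡sign[a] a = cong sign (⌊2a/2⌋≡a a)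

  σ[1+2a]≡sign[a] : ∀ a → σ (suc (2 ℕ.* a)) ≡ sign a
  σ[1+2a]≡sign[a] a = cong sign (trans (cong ⌊_/2⌋ (sym (ℕ.+-comm (2 ℕ.* a) 1)))
                                        (trans (⌊[2a+r]/2⌋≡a+⌊r/2⌋ a 1) (ℕ.+-identityʳ a)))

  σ[1+2a+m]≡sign[a]*σ[1+m] : ∀ a m → σ (suc (2 ℕ.* a) ℕ.+ m) ≡ sign a ℚ.* σ (suc m)
  σ[1+2a+m]≡sign[a]*σ[1+m] a m = begin
    sign ⌊ suc (2 ℕ.* a ℕ.+ m) /2⌋      ≡⟨ cong (λ j → sign ⌊ j /2⌋) (sym (ℕ.+-suc (2 ℕ.* a) m)) ⟩
    sign ⌊ 2 ℕ.* a ℕ.+ suc m /2⌋        ≡⟨ cong sign (⌊[2a+r]/2⌋≡a+⌊r/2⌋ a (suc m)) ⟩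
    sign (a ℕ.+ ⌊ suc m /2⌋)            ≡⟨ sign-+ a _ ⟩
    sign a ℚ.* σ (suc m)                ∎
    where open ≡-Reasoning

  0ℙ≢1ℙ : 0ℙ ≢ 1ℙ
  0ℙ≢1ℙ ()

  parity[2a]≡0 : ∀ a → ℕ.parity (2 ℕ.* a) ≡ 0ℙ
  parity[2a]≡0 a = ℙ.*-homo-* 2 a

  parity[1+2a]≡1 : ∀ a → ℕ.parity (suc (2 ℕ.* a)) ≡ 1ℙ
  parity[1+2a]≡1 a = trans (ℙ.+-homo-+ 1 (2 ℕ.* a)) (cong (1ℙ ℙ.+_) (parity[2a]≡0 a))

  σ[1+k]*σ[1+m]≡σ[k]*σ[m] : ∀ k m → ℕ.parity m ≡ ℕ.parity k → σ (suc k) ℚ.* σ (suc m) ≡ σ k ℚ.* σ m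
  σ[1+k]*σ[1+m]≡σ[k]*σ[m] k m parities with evenOdd k | evenOdd m
  ... | even b | even c = cong₂ ℚ._*_ (trans (σ[1+2a]≡sign[a] b) (sym (σ[2a]≡sign[a] b)))
                                       (trans (σ[1+2a]≡sign[a] c) (sym (σ[2a]≡sign[a] c)))
  ... | odd b  | odd c  = begin
    ℚ.- σ (2 ℕ.* b) ℚ.* ℚ.- σ (2 ℕ.* c)
      ≡⟨ -x*-y≡x*y (σ (2 ℕ.* b)) (σ (2 ℕ.* c)) ⟩
    σ (2 ℕ.* b) ℚ.* σ (2 ℕ.* c)
      ≡⟨ cong₂ ℚ._*_ (σ[2a]≡sign[a] b) (σ[2a]≡sign[a] c) ⟩
    sign b ℚ.* sign c
      ≡⟨ sym (cong₂ ℚ._*_ (σ[1+2a]≡sign[a] b) (σ[1+2a]≡sign[a] c)) ⟩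
    σ (suc (2 ℕ.* b)) ℚ.* σ (suc (2 ℕ.* c)) ∎
    where open ≡-Reasoning
  ... | even b | odd c  = ⊥-elim (0ℙ≢1ℙ (trans (sym (parity[2a]≡0 b)) (trans (sym parities) (parity[1+2a]≡1 c))))
  ... | odd b  | even c = ⊥-elim (0ℙ≢1ℙ (trans (sym (parity[2a]≡0 c)) (trans parities (parity[1+2a]≡1 b))))

  -- The coefficients of 2 sinh(x/2).
  sinhHalf : Series
  sinhHalf j = σ j ℚ.* twoSinHalf j

  twoSinHalf≡σ*sinhHalf : ∀ j → twoSinHalf j ≡ σ j ℚ.* sinhHalf j
  twoSinHalf≡σ*sinhHalf j = sym (trans (sym (ℚ.*-assoc (σ j) (σ j) _)) (trans (cong (ℚ._* twoSinHalf j) (sign*sign≡1 ⌊ j /2⌋)) (ℚ.*-identityˡ _)))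

  sinhHalf-even : ∀ a → sinhHalf (2 ℕ.* a) ≡ 0ℚ
  sinhHalf-even a = trans (cong (σ (2 ℕ.* a) ℚ.*_) (twoSinHalf-even a)) (ℚ.*-zeroʳ (σ (2 ℕ.* a)))

  sinhHalf-odd : ∀ a → sinhHalf (suc (2 ℕ.* a)) ≡ (+ 1) /ℕ (4 ℕ.^ a ℕ.* suc (2 ℕ.* a) !)
  sinhHalf-odd a = begin
    σ (suc (2 ℕ.* a)) ℚ.* twoSinHalf (suc (2 ℕ.* a)) ≡⟨ cong₂ ℚ._*_ (σ[1+2a]≡sign[a] a) (twoSinHalf-odd a) ⟩
    sign a ℚ.* (signQ a ℚ.* r)                       ≡⟨ cong (λ s → sign a ℚ.* (s ℚ.* r)) (signQ≡sign a) ⟩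
    sign a ℚ.* (sign a ℚ.* r)                        ≡⟨ sym (ℚ.*-assoc (sign a) (sign a) r) ⟩
    sign a ℚ.* sign a ℚ.* r                          ≡⟨ trans (cong (ℚ._* r) (sign*sign≡1 a)) (ℚ.*-identityˡ r) ⟩
    r                                                ∎
    where
    open ≡-Reasoning
    r = (+ 1) /ℕ (4 ℕ.^ a ℕ.* suc (2 ℕ.* a) !)

  sinhHalf^k-vanishes : ∀ k n → ℕ.parity n ≢ ℕ.parity k → (sinhHalf ^ˢ k) n ≡ 0ℚ
  sinhHalf^k-vanishes zero    zero    parities = ⊥-elim (parities refl)
  sinhHalf^k-vanishes zero    (suc n) parities = refl
  sinhHalf^k-vanishes (suc k) n       parities =
    trans (sumTo≡∑ (suc n) _) (∑-zero (suc n) _ (λ i i<1+n → term i (ℕ.≤-pred i<1+n)))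
    where
    term : ∀ i → i ≤ n → sinhHalf i ℚ.* (sinhHalf ^ˢ k) (n ∸ i) ≡ 0ℚ
    term i i≤n with evenOdd i
    ... | even a = trans (cong (ℚ._* (sinhHalf ^ˢ k) (n ∸ 2 ℕ.* a)) (sinhHalf-even a)) (ℚ.*-zeroˡ ((sinhHalf ^ˢ k) (n ∸ 2 ℕ.* a)))
    ... | odd a  = trans (cong (sinhHalf (suc (2 ℕ.* a)) ℚ.*_) (sinhHalf^k-vanishes k (n ∸ suc (2 ℕ.* a)) mismatch)) (ℚ.*-zeroʳ (sinhHalf (suc (2 ℕ.* a))))
      where
      mismatch : ℕ.parity (n ∸ suc (2 ℕ.* a)) ≢ ℕ.parity k
      mismatch same = parities (begin
        ℕ.parity n                                              ≡⟨ cong ℕ.parity (sym (ℕ.m+[n∸m]≡n i≤n)) ⟩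
        ℕ.parity (suc (2 ℕ.* a) ℕ.+ (n ∸ suc (2 ℕ.* a)))         ≡⟨ ℙ.+-homo-+ (suc (2 ℕ.* a)) _ ⟩
        ℕ.parity (suc (2 ℕ.* a)) ℙ.+ ℕ.parity (n ∸ suc (2 ℕ.* a)) ≡⟨ cong₂ ℙ._+_ (parity[1+2a]≡1 a) same ⟩
        1ℙ ℙ.+ ℕ.parity k                                       ≡⟨ sym (ℙ.+-homo-+ 1 k) ⟩
        ℕ.parity (suc k)                                        ∎)
        where open ≡-Reasoning

  twoSinHalf^k≡σ*σ*sinhHalf^k : ∀ k n → (twoSinHalf ^ˢ k) n ≡ σ k ℚ.* (σ n ℚ.* (sinhHalf ^ˢ k) n)
  twoSinHalf^k≡σ*σ*sinhHalf^k zero    zero    = sym (trans (ℚ.*-identityˡ _) (ℚ.*-identityˡ _))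
  twoSinHalf^k≡σ*σ*sinhHalf^k zero    (suc n) = sym (trans (cong (σ 0 ℚ.*_) (ℚ.*-zeroʳ (σ (suc n)))) (ℚ.*-zeroʳ (σ 0)))
  twoSinHalf^k≡σ*σ*sinhHalf^k (suc k) n       = begin
    sumTo (suc n) (λ i → twoSinHalf i ℚ.* (twoSinHalf ^ˢ k) (n ∸ i))
      ≡⟨ sumTo≡∑ (suc n) _ ⟩
    ∑ (suc n) (λ i → twoSinHalf i ℚ.* (twoSinHalf ^ˢ k) (n ∸ i))
      ≡⟨ ∑-cong< (suc n) (λ i i<1+n → term i (ℕ.≤-pred i<1+n)) ⟩
    ∑ (suc n) (λ i → σ (suc k) ℚ.* (σ n ℚ.* u i))
      ≡⟨ sym (trans (*-distribˡ-∑ (suc n) (σ (suc k)) _) (∑-cong (suc n) (λ i → cong (σ (suc k) ℚ.*_) refl))) ⟩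
    σ (suc k) ℚ.* ∑ (suc n) (λ i → σ n ℚ.* u i)
      ≡⟨ cong (σ (suc k) ℚ.*_) (sym (*-distribˡ-∑ (suc n) (σ n) u)) ⟩
    σ (suc k) ℚ.* (σ n ℚ.* ∑ (suc n) u)
      ≡⟨ cong (λ z → σ (suc k) ℚ.* (σ n ℚ.* z)) (sym (sumTo≡∑ (suc n) u)) ⟩
    σ (suc k) ℚ.* (σ n ℚ.* (sinhHalf ^ˢ suc k) n) ∎
    where
    open ≡-Reasoning
    u : ℕ → ℚ
    u i = sinhHalf i ℚ.* (sinhHalf ^ˢ k) (n ∸ i)
    term : ∀ i → i ≤ n → twoSinHalf i ℚ.* (twoSinHalf ^ˢ k) (n ∸ i) ≡ σ (suc k) ℚ.* (σ n ℚ.* u i)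
    term i i≤n = begin
      twoSinHalf i ℚ.* (twoSinHalf ^ˢ k) m
        ≡⟨ cong₂ ℚ._*_ (twoSinHalf≡σ*sinhHalf i) (twoSinHalf^k≡σ*σ*sinhHalf^k k m) ⟩
      σ i ℚ.* sinhHalf i ℚ.* (σ k ℚ.* (σ m ℚ.* T))
        ≡⟨ regroup (σ i) (sinhHalf i) (σ k) (σ m) T ⟩
      σ i ℚ.* σ k ℚ.* σ m ℚ.* u i
        ≡⟨ signs-or-vanishing ⟩
      σ (suc k) ℚ.* (σ n ℚ.* u i) ∎
      where
      m = n ∸ i
      T = (sinhHalf ^ˢ k) m
      regroup : ∀ a x b c y → a ℚ.* x ℚ.* (b ℚ.* (c ℚ.* y)) ≡ a ℚ.* b ℚ.* c ℚ.* (x ℚ.* y)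
      regroup = solve 5 (λ a x b c y → a :* x :* (b :* (c :* y)) := a :* b :* c :* (x :* y)) refl
      vanishing : u i ≡ 0ℚ → σ i ℚ.* σ k ℚ.* σ m ℚ.* u i ≡ σ (suc k) ℚ.* (σ n ℚ.* u i)
      vanishing uᵢ≡0 rewrite uᵢ≡0 = trans (ℚ.*-zeroʳ (σ i ℚ.* σ k ℚ.* σ m)) (sym (trans (cong (σ (suc k) ℚ.*_) (ℚ.*-zeroʳ (σ n))) (ℚ.*-zeroʳ (σ (suc k)))))
      signs-or-vanishing : σ i ℚ.* σ k ℚ.* σ m ℚ.* u i ≡ σ (suc k) ℚ.* (σ n ℚ.* u i)
      signs-or-vanishing with evenOdd i
      ... | even a = vanishing (trans (cong (ℚ._* T) (sinhHalf-even a)) (ℚ.*-zeroˡ T))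
      ... | odd a with ℕ.parity m ℙ.≟ ℕ.parity k
      ...   | no mismatch = vanishing (trans (cong (sinhHalf i ℚ.*_) (sinhHalf^k-vanishes k m mismatch)) (ℚ.*-zeroʳ (sinhHalf i)))
      ...   | yes same = trans (cong (ℚ._* u i) signs) (ℚ.*-assoc (σ (suc k)) (σ n) (u i))
        where
        signs : σ i ℚ.* σ k ℚ.* σ m ≡ σ (suc k) ℚ.* σ n
        signs = begin
          σ i ℚ.* σ k ℚ.* σ m                      ≡⟨ ℚ.*-assoc (σ i) (σ k) (σ m) ⟩
          σ i ℚ.* (σ k ℚ.* σ m)                    ≡⟨ cong₂ ℚ._*_ (σ[1+2a]≡sign[a] a) (sym (σ[1+k]*σ[1+m]≡σ[k]*σ[m] k m same)) ⟩
          sign a ℚ.* (σ (suc k) ℚ.* σ (suc m))     ≡⟨ *-Props.x∙yz≈y∙xz (sign a) (σ (suc k)) (σ (suc m)) ⟩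
          σ (suc k) ℚ.* (sign a ℚ.* σ (suc m))     ≡⟨ cong (σ (suc k) ℚ.*_) (sym (σ[1+2a+m]≡sign[a]*σ[1+m] a m)) ⟩
          σ (suc k) ℚ.* σ (i ℕ.+ m)                ≡⟨ cong (λ j → σ (suc k) ℚ.* σ j) (ℕ.m+[n∸m]≡n i≤n) ⟩
          σ (suc k) ℚ.* σ n                        ∎

  egf : Series → ℕ → ℚ
  egf a n = ι (+ (n !)) ℚ.* a n

  ι[+n]≡fromℕ : ∀ n → ι (+ n) ≡ fromℕ n
  ι[+n]≡fromℕ n = trans (cong ι (sym (IntegerDifferences.fromℕ≡+ n))) (ι-fromℕ n)

  ι[+m*n] : ∀ m n → ι (+ (m ℕ.* n)) ≡ ι (+ m) ℚ.* ι (+ n)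
  ι[+m*n] m n = trans (cong ι (ℤ.pos-* m n)) (ι-* (+ m) (+ n))

  ι[+m^n] : ∀ m n → ι (+ (m ℕ.^ n)) ≡ ι (+ m) ^ n
  ι[+m^n] m zero    = refl
  ι[+m^n] m (suc n) = trans (ι[+m*n] m (m ℕ.^ n)) (cong (ι (+ m) ℚ.*_) (ι[+m^n] m n))

  egf-⊛ : ∀ a b n → egf (a ⊛ b) n ≡ ∑ (suc n) (λ i → fromℕ (n C i) ℚ.* (egf a i ℚ.* egf b (n ∸ i)))
  egf-⊛ a b n = begin
    ι (+ (n !)) ℚ.* sumTo (suc n) (λ i → a i ℚ.* b (n ∸ i))   ≡⟨ cong (ι (+ (n !)) ℚ.*_) (sumTo≡∑ (suc n) _) ⟩
    ι (+ (n !)) ℚ.* ∑ (suc n) (λ i → a i ℚ.* b (n ∸ i))       ≡⟨ *-distribˡ-∑ (suc n) (ι (+ (n !))) _ ⟩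
    ∑ (suc n) (λ i → ι (+ (n !)) ℚ.* (a i ℚ.* b (n ∸ i)))     ≡⟨ ∑-cong< (suc n) (λ i i<1+n → term i (ℕ.≤-pred i<1+n)) ⟩
    ∑ (suc n) (λ i → fromℕ (n C i) ℚ.* (egf a i ℚ.* egf b (n ∸ i))) ∎
    where
    open ≡-Reasoning
    term : ∀ i → i ≤ n → ι (+ (n !)) ℚ.* (a i ℚ.* b (n ∸ i)) ≡ fromℕ (n C i) ℚ.* (egf a i ℚ.* egf b (n ∸ i))
    term i i≤n = begin
      ι (+ (n !)) ℚ.* (a i ℚ.* b (n ∸ i))
        ≡⟨ cong (λ m → ι (+ m) ℚ.* (a i ℚ.* b (n ∸ i))) (sym (Factorials.nCk*[k!*[n∸k]!]≡n! i≤n)) ⟩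
      ι (+ ((n C i) ℕ.* (i ! ℕ.* (n ∸ i) !))) ℚ.* (a i ℚ.* b (n ∸ i))
        ≡⟨ cong (ℚ._* (a i ℚ.* b (n ∸ i))) (trans (ι[+m*n] (n C i) _) (cong₂ ℚ._*_ (ι[+n]≡fromℕ (n C i)) (ι[+m*n] (i !) ((n ∸ i) !)))) ⟩
      fromℕ (n C i) ℚ.* (ι (+ (i !)) ℚ.* ι (+ ((n ∸ i) !))) ℚ.* (a i ℚ.* b (n ∸ i))
        ≡⟨ regroup (fromℕ (n C i)) (ι (+ (i !))) (ι (+ ((n ∸ i) !))) (a i) (b (n ∸ i)) ⟩
      fromℕ (n C i) ℚ.* (egf a i ℚ.* egf b (n ∸ i)) ∎
      where
      regroup : ∀ c f g x y → c ℚ.* (f ℚ.* g) ℚ.* (x ℚ.* y) ≡ c ℚ.* (f ℚ.* x ℚ.* (g ℚ.* y))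
      regroup = solve 5 (λ c f g x y → c :* (f :* g) :* (x :* y) := c :* (f :* x :* (g :* y))) refl

  egf-sinhHalf : ∀ j → egf sinhHalf j ≡ ½ ^ j ℚ.- (ℚ.- ½) ^ j
  egf-sinhHalf j with evenOdd j
  ... | even a = begin
    ι (+ ((2 ℕ.* a) !)) ℚ.* sinhHalf (2 ℕ.* a)  ≡⟨ trans (cong (ι (+ ((2 ℕ.* a) !)) ℚ.*_) (sinhHalf-even a)) (ℚ.*-zeroʳ (ι (+ ((2 ℕ.* a) !)))) ⟩
    0ℚ                                         ≡⟨ sym (x-1*x≡0 (½ ^ (2 ℕ.* a))) ⟩
    ½ ^ (2 ℕ.* a) ℚ.- 1ℚ ℚ.* ½ ^ (2 ℕ.* a)       ≡⟨ cong (λ s → ½ ^ (2 ℕ.* a) ℚ.- s ℚ.* ½ ^ (2 ℕ.* a)) (sym (sign[2n]≡1 a)) ⟩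
    ½ ^ (2 ℕ.* a) ℚ.- sign (2 ℕ.* a) ℚ.* ½ ^ (2 ℕ.* a) ≡⟨ cong (λ z → ½ ^ (2 ℕ.* a) ℚ.- z) (sym ([-x]^n≡sign[n]*x^n ½ (2 ℕ.* a))) ⟩
    ½ ^ (2 ℕ.* a) ℚ.- (ℚ.- ½) ^ (2 ℕ.* a)       ∎
    where
    open ≡-Reasoning
    x-1*x≡0 : ∀ x → x ℚ.- 1ℚ ℚ.* x ≡ 0ℚ
    x-1*x≡0 = solve 1 (λ x → x :- con 1ℚ :* x := con 0ℚ) refl
  ... | odd a = begin
    ι (+ (j !)) ℚ.* sinhHalf j         ≡⟨ cong (ι (+ (j !)) ℚ.*_) (sinhHalf-odd a) ⟩
    ι (+ (j !)) ℚ.* r                  ≡⟨ inverses-agree (ι (+ 4) ^ a) uv≡1 uw≡1 ⟩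
    (½ ^ 2) ^ a                        ≡⟨ ^-assocʳ ½ 2 a ⟩
    ½ ^ (2 ℕ.* a)                      ≡⟨ sym (trans (two-halves ½ (½ ^ (2 ℕ.* a))) (ℚ.*-identityˡ _)) ⟩
    ½ ^ j ℚ.- ℚ.- 1ℚ ℚ.* ½ ^ j          ≡⟨ cong (λ s → ½ ^ j ℚ.- ℚ.- s ℚ.* ½ ^ j) (sym (sign[2n]≡1 a)) ⟩
    ½ ^ j ℚ.- sign j ℚ.* ½ ^ j          ≡⟨ cong (λ z → ½ ^ j ℚ.- z) (sym ([-x]^n≡sign[n]*x^n ½ j)) ⟩
    ½ ^ j ℚ.- (ℚ.- ½) ^ j               ∎
    where
    open ≡-Reasoning
    r = (+ 1) /ℕ (4 ℕ.^ a ℕ.* j !)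
    two-halves : ∀ h x → h ℚ.* x ℚ.- ℚ.- 1ℚ ℚ.* (h ℚ.* x) ≡ (h ℚ.+ h) ℚ.* x
    two-halves = solve 2 (λ h x → h :* x :- :- con 1ℚ :* (h :* x) := (h :+ h) :* x) refl
    inverses-agree : ∀ u {v w} → u ℚ.* v ≡ 1ℚ → u ℚ.* w ≡ 1ℚ → v ≡ w
    inverses-agree u {v} {w} uv≡1 uw≡1 = begin
      v                  ≡⟨ sym (ℚ.*-identityˡ v) ⟩
      1ℚ ℚ.* v           ≡⟨ cong (ℚ._* v) (sym uw≡1) ⟩
      u ℚ.* w ℚ.* v      ≡⟨ *-Props.xy∙z≈y∙xz u w v ⟩
      w ℚ.* (u ℚ.* v)    ≡⟨ trans (cong (w ℚ.*_) uv≡1) (ℚ.*-identityʳ w) ⟩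
      w                  ∎
    uv≡1 : ι (+ 4) ^ a ℚ.* (ι (+ (j !)) ℚ.* r) ≡ 1ℚ
    uv≡1 = begin
      ι (+ 4) ^ a ℚ.* (ι (+ (j !)) ℚ.* r)   ≡⟨ sym (ℚ.*-assoc (ι (+ 4) ^ a) (ι (+ (j !))) r) ⟩
      ι (+ 4) ^ a ℚ.* ι (+ (j !)) ℚ.* r     ≡⟨ cong (ℚ._* r) (sym (trans (ι[+m*n] (4 ℕ.^ a) (j !)) (cong (ℚ._* ι (+ (j !))) (ι[+m^n] 4 a)))) ⟩
      ι (+ (4 ℕ.^ a ℕ.* j !)) ℚ.* r         ≡⟨ ι[n]*[1/n]≡1 _ (ℕ.>-nonZero⁻¹ _ {{ℕ.m*n≢0 (4 ℕ.^ a) (j !) {{ℕ.m^n≢0 4 a}} {{j ℕ.!≢0}}}}) ⟩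
      1ℚ                                   ∎
    uw≡1 : ι (+ 4) ^ a ℚ.* (½ ^ 2) ^ a ≡ 1ℚ
    uw≡1 = trans (sym (^-distrib-* (ι (+ 4)) (½ ^ 2) a)) (trans (cong (_^ a) 4*¼≡1) (1^n≡1 a))
      where
      4*¼≡1 : ι (+ 4) ℚ.* ½ ^ 2 ≡ 1ℚ
      4*¼≡1 = refl

  egf-sinhHalf^k : ∀ k n → egf (sinhHalf ^ˢ k) n ≡ Δ k n (ℚ.- (fromℕ k ℚ.* ½))
  egf-sinhHalf^k zero    zero    = refl
  egf-sinhHalf^k zero    (suc n) = trans (ℚ.*-zeroʳ (ι (+ (suc n !)))) (sym (ℚ.*-zeroˡ ((ℚ.- (fromℕ 0 ℚ.* ½)) ^ n)))
  egf-sinhHalf^k (suc k) n       = begin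
    egf (sinhHalf ⊛ (sinhHalf ^ˢ k)) n
      ≡⟨ egf-⊛ sinhHalf (sinhHalf ^ˢ k) n ⟩
    ∑ (suc n) (λ i → c i ℚ.* (egf sinhHalf i ℚ.* egf (sinhHalf ^ˢ k) (n ∸ i)))
      ≡⟨ ∑-cong (suc n) (λ i → cong₂ (λ e f → c i ℚ.* (e ℚ.* f)) (egf-sinhHalf i) (egf-sinhHalf^k k (n ∸ i))) ⟩
    ∑ (suc n) (λ i → c i ℚ.* ((½ ^ i ℚ.- (ℚ.- ½) ^ i) ℚ.* D i))
      ≡⟨ ∑-cong (suc n) (λ i → distrib (c i) (½ ^ i) ((ℚ.- ½) ^ i) (D i)) ⟩
    ∑ (suc n) (λ i → c i ℚ.* (½ ^ i ℚ.* D i) ℚ.- c i ℚ.* ((ℚ.- ½) ^ i ℚ.* D i))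
      ≡⟨ ∑[f-g]≡∑f-∑g (suc n) _ _ ⟩
    ∑ (suc n) (λ i → c i ℚ.* (½ ^ i ℚ.* D i)) ℚ.- ∑ (suc n) (λ i → c i ℚ.* ((ℚ.- ½) ^ i ℚ.* D i))
      ≡⟨ cong₂ ℚ._-_ (Δ-binomial k n x ½) (Δ-binomial k n x (ℚ.- ½)) ⟩
    Δ k n (x ℚ.+ ½) ℚ.- Δ k n (x ℚ.+ ℚ.- ½)
      ≡⟨ cong₂ (λ y z → Δ k n y ℚ.- Δ k n z) (shift-up (fromℕ k)) (shift-down (fromℕ k)) ⟩
    Δ (suc k) n (ℚ.- (fromℕ (suc k) ℚ.* ½)) ∎
    where
    open ≡-Reasoning
    x = ℚ.- (fromℕ k ℚ.* ½)
    c : ℕ → ℚ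
    c i = fromℕ (n C i)
    D : ℕ → ℚ
    D i = Δ k (n ∸ i) x
    distrib : ∀ c a b d → c ℚ.* ((a ℚ.- b) ℚ.* d) ≡ c ℚ.* (a ℚ.* d) ℚ.- c ℚ.* (b ℚ.* d)
    distrib = solve 4 (λ c a b d → c :* ((a :- b) :* d) := c :* (a :* d) :- c :* (b :* d)) refl
    shift-up : ∀ v → ℚ.- (v ℚ.* ½) ℚ.+ ½ ≡ ℚ.- ((1ℚ ℚ.+ v) ℚ.* ½) ℚ.+ 1ℚ
    shift-up = solve 1 (λ v → :- (v :* con ½) :+ con ½ := :- ((con 1ℚ :+ v) :* con ½) :+ con 1ℚ) refl
    shift-down : ∀ v → ℚ.- (v ℚ.* ½) ℚ.+ ℚ.- ½ ≡ ℚ.- ((1ℚ ℚ.+ v) ℚ.* ½)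
    shift-down = solve 1 (λ v → :- (v :* con ½) :+ :- con ½ := :- ((con 1ℚ :+ v) :* con ½)) refl

module OddModuli where

  open import Data.Nat as ℕ using (ℕ; zero; suc; _<_; _!)
  import Data.Nat.Properties as ℕ
  import Data.Nat.Divisibility as ℕ
  open import Data.Nat.Primality using (Prime; ¬prime⇒composite)
  open import Data.Integer using (ℤ; +_; -_)
  import Data.Integer.Properties as ℤ
  open import Data.Integer.Divisibility.Signed
  open import Relation.Nullary using (¬_)
  open import Relation.Binary.PropositionalEquality using (sym)
  open IntegerDifferences

  composite∣Δ : ∀ m n → ¬ Prime (suc (2 ℕ.* m)) → + suc (2 ℕ.* m) ∣ Δ (2 ℕ.* m) n (- + m)
  composite∣Δ zero    n _       = divides (Δ 0 n (- + 0)) (sym (ℤ.*-identityʳ _))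
  composite∣Δ (suc m) n ¬prime = ∣-trans (∣ᵤ⇒∣ q∣[q∸1]!) (k!∣Δ (2 ℕ.* suc m) n (- + suc m))
    where
    q∣[q∸1]! : suc (2 ℕ.* suc m) ℕ.∣ (2 ℕ.* suc m) !
    q∣[q∸1]! = Factorials.composite∣[n∸1]! (¬prime⇒composite ¬prime) (λ q≡4 → ℕ.even≢odd 2 (suc m) (sym q≡4))

  -- p ∸ 2 = 2m ∸ 1 is written as m-1 + (1 + (m-1 + 0)) so that 2 + (p ∸ 2) is definitionally 1 + 2m.
  module _ (m-1 : ℕ) (p-prime : Prime (suc (2 ℕ.* suc m-1))) where

    open PrimeModulus (m-1 ℕ.+ suc (m-1 ℕ.+ 0)) p-prime
    open Congruence (+ suc (2 ℕ.* suc m-1))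

    prime-Δ≈0 : ∀ n → ¬ (2 ℕ.* suc m-1 ℕ.∣ n) → Δ (2 ℕ.* suc m-1) n (- + suc m-1) ≈ + 0
    prime-Δ≈0 n p-1∤n = ≈-trans (Δ[p-1]≈powerSum (sign[2n]≡1 (suc m-1)) n (suc m-1)) (powerSum≈0 p-1∤n)

    prime-Δ≈-1 : ∀ n → 2 ℕ.* suc m-1 ℕ.∣ n → 0 < n → Δ (2 ℕ.* suc m-1) n (- + suc m-1) ≈ - + 1
    prime-Δ≈-1 n p-1∣n 0<n = ≈-trans (Δ[p-1]≈powerSum (sign[2n]≡1 (suc m-1)) n (suc m-1)) (powerSum≈-1 p-1∣n 0<n)

module Integrality where

  open import Data.Nat as ℕ using (ℕ; zero; suc; _∸_; _<_; _≤_; _!; _≟_; z<s)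
  import Data.Nat.Properties as ℕ
  import Data.Nat.Divisibility as ℕ
  open import Data.Nat.DivMod using (_%_; _/_; m*n/n≡m)
  open import Data.Nat.Primality using (Prime; prime?; ¬prime[1])
  open import Data.Integer as ℤ using (ℤ; +_)
  import Data.Integer.Properties as ℤ
  open import Data.Integer.Tactic.RingSolver using (solve-∀)
  open import Data.Integer.Divisibility.Signed as ℤ using (divides) renaming (_∣_ to _∣ℤ_)
  open import Data.Rational as ℚ using (ℚ; 0ℚ; 1ℚ; ½)
  import Data.Rational.Properties as ℚ
  open import Data.Product using (Σ; _,_)
  open import Data.Empty using (⊥-elim)
  open import Relation.Nullary using (¬_; Dec; yes; no)
  open import Relation.Binary.PropositionalEquality
  open RationalEmbedding
  open Series using (twoSinHalf^k≡σ*σ*sinhHalf^k; egf; egf-sinhHalf^k; σ[2a]≡sign[a]; ι[+n]≡fromℕ; [2a]%2≡0; [1+2a]%2≡1)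
  open import Data.Rational.Solver using (module +-*-Solver)
  open +-*-Solver using (solve; _:+_; _:*_; :-_; _:=_; con)

  primeTerm-nonprime : ∀ N p → ¬ Prime p → primeTerm N p ≡ 0ℚ
  primeTerm-nonprime N p ¬prime with prime? p
  ... | yes q-prime = ⊥-elim (¬prime q-prime)
  ... | no _        = refl

  primeTerm-even : ∀ N a → primeTerm N (2 ℕ.* a) ≡ 0ℚ
  primeTerm-even N a with prime? (2 ℕ.* a) | (2 ℕ.* a) % 2 ≟ 1
  ... | yes _ | yes odd = ⊥-elim (ℕ.0≢1+n (trans (sym ([2a]%2≡0 a)) odd))
  ... | yes _ | no _    = refl
  ... | no _  | _       = refl

  primeTerm-∤ : ∀ N p → ¬ (p ∸ 1 ℕ.∣ 2 ℕ.* N) → primeTerm N p ≡ 0ℚ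
  primeTerm-∤ N p ∤ with prime? p | p % 2 ≟ 1 | p ∸ 1 ℕ.∣? 2 ℕ.* N
  ... | yes _ | yes _ | yes ∣ = ⊥-elim (∤ ∣)
  ... | yes _ | yes _ | no _  = refl
  ... | yes _ | no _  | _     = refl
  ... | no _  | _     | _     = refl

  primeTerm-∣ : ∀ N m → Prime (suc (2 ℕ.* m)) → 2 ℕ.* m ℕ.∣ 2 ℕ.* N →
                primeTerm N (suc (2 ℕ.* m)) ≡ signQ (N ∸ m) ℚ.* ((+ 1) /ℕ suc (2 ℕ.* m))
  primeTerm-∣ N m q-prime ∣ with prime? (suc (2 ℕ.* m)) | suc (2 ℕ.* m) % 2 ≟ 1 | 2 ℕ.* m ℕ.∣? 2 ℕ.* N
  ... | yes _ | yes _   | yes _ = cong (λ h → signQ (N ∸ h) ℚ.* ((+ 1) /ℕ suc (2 ℕ.* m))) (trans (cong (_/ 2) (ℕ.*-comm 2 m)) (m*n/n≡m m 2))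
  ... | yes _ | yes _   | no ∤  = ⊥-elim (∤ ∣)
  ... | yes _ | no even | _     = ⊥-elim (even ([1+2a]%2≡1 m))
  ... | no ¬prime | _   | _     = ⊥-elim (¬prime q-prime)

  IsInteger-+ : ∀ {a b} → IsInteger a → IsInteger b → IsInteger (a ℚ.+ b)
  IsInteger-+ (z , refl) (w , refl) = z ℤ.+ w , sym (ι-+ z w)

  IsInteger-∑ : ∀ n (f : ℕ → ℚ) → (∀ i → i < n → IsInteger (f i)) → IsInteger (∑ n f)
  IsInteger-∑ zero    f _     = + 0 , refl
  IsInteger-∑ (suc n) f f-int = IsInteger-+ (IsInteger-∑ n f (λ i i<n → f-int i (ℕ.m<n⇒m<1+n i<n))) (f-int n ℕ.≤-refl)

  IsInteger-ι*1/q : ∀ z q → + suc q ∣ℤ z → IsInteger (ι z ℚ.* ((+ 1) /ℕ suc q))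
  IsInteger-ι*1/q z q (divides c refl) = c , (begin
    ι (c ℤ.* + suc q) ℚ.* r        ≡⟨ cong (ℚ._* r) (ι-* c (+ suc q)) ⟩
    ι c ℚ.* ι (+ suc q) ℚ.* r      ≡⟨ ℚ.*-assoc (ι c) (ι (+ suc q)) r ⟩
    ι c ℚ.* (ι (+ suc q) ℚ.* r)    ≡⟨ cong (ι c ℚ.*_) (ι[n]*[1/n]≡1 (suc q) z<s) ⟩
    ι c ℚ.* 1ℚ                     ≡⟨ ℚ.*-identityʳ (ι c) ⟩
    ι c                            ∎)
    where
    open ≡-Reasoning
    r = (+ 1) /ℕ suc q

  signedΔ : ℕ → ℕ → ℤ
  signedΔ n m = ℤ-Sums.sign m ℤ.* ℤ-Sums.sign n ℤ.* ℤ-Sums.Δ (2 ℕ.* m) (2 ℕ.* n) (ℤ.- + m)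

  egf-twoSinHalf^[2m] : ∀ n m → egf (twoSinHalf ^ˢ (2 ℕ.* m)) (2 ℕ.* n) ≡ ι (signedΔ n m)
  egf-twoSinHalf^[2m] n m = begin
    ι (+ ((2 ℕ.* n) !)) ℚ.* (twoSinHalf ^ˢ (2 ℕ.* m)) (2 ℕ.* n)
      ≡⟨ cong (ι (+ ((2 ℕ.* n) !)) ℚ.*_) (twoSinHalf^k≡σ*σ*sinhHalf^k (2 ℕ.* m) (2 ℕ.* n)) ⟩
    ι (+ ((2 ℕ.* n) !)) ℚ.* (σ (2 ℕ.* m) ℚ.* (σ (2 ℕ.* n) ℚ.* T))
      ≡⟨ regroup (ι (+ ((2 ℕ.* n) !))) (σ (2 ℕ.* m)) (σ (2 ℕ.* n)) T ⟩
    σ (2 ℕ.* m) ℚ.* σ (2 ℕ.* n) ℚ.* egf (sinhHalf ^ˢ (2 ℕ.* m)) (2 ℕ.* n)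
      ≡⟨ cong₂ (λ s e → s ℚ.* e) (cong₂ ℚ._*_ (σ[2a]≡sign[a] m) (σ[2a]≡sign[a] n)) (egf-sinhHalf^k (2 ℕ.* m) (2 ℕ.* n)) ⟩
    sign m ℚ.* sign n ℚ.* Δ (2 ℕ.* m) (2 ℕ.* n) (ℚ.- (fromℕ (2 ℕ.* m) ℚ.* ½))
      ≡⟨ cong (λ x → sign m ℚ.* sign n ℚ.* Δ (2 ℕ.* m) (2 ℕ.* n) x) -[2m*½]≡ι[-m] ⟩
    sign m ℚ.* sign n ℚ.* Δ (2 ℕ.* m) (2 ℕ.* n) (ι (ℤ.- + m))
      ≡⟨ sym (cong₂ ℚ._*_ (cong₂ ℚ._*_ (ι-sign m) (ι-sign n)) (ι-Δ (2 ℕ.* m) (2 ℕ.* n) (ℤ.- + m))) ⟩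
    ι (ℤ-Sums.sign m) ℚ.* ι (ℤ-Sums.sign n) ℚ.* ι (ℤ-Sums.Δ (2 ℕ.* m) (2 ℕ.* n) (ℤ.- + m))
      ≡⟨ sym (trans (ι-* (sm ℤ.* sn) d) (cong (ℚ._* ι d) (ι-* sm sn))) ⟩
    ι (signedΔ n m) ∎
    where
    open ≡-Reasoning
    open Series using (σ; sinhHalf)
    T = (sinhHalf ^ˢ (2 ℕ.* m)) (2 ℕ.* n)
    sm = ℤ-Sums.sign m
    sn = ℤ-Sums.sign n
    d = ℤ-Sums.Δ (2 ℕ.* m) (2 ℕ.* n) (ℤ.- + m)
    regroup : ∀ f a b t → f ℚ.* (a ℚ.* (b ℚ.* t)) ≡ a ℚ.* b ℚ.* (f ℚ.* t)
    regroup = solve 4 (λ f a b t → f :* (a :* (b :* t)) := a :* b :* (f :* t)) refl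
    -[2m*½]≡ι[-m] : ℚ.- (fromℕ (2 ℕ.* m) ℚ.* ½) ≡ ι (ℤ.- + m)
    -[2m*½]≡ι[-m] = begin
      ℚ.- (fromℕ (m ℕ.+ (m ℕ.+ 0)) ℚ.* ½)   ≡⟨ cong (λ k → ℚ.- (fromℕ (m ℕ.+ k) ℚ.* ½)) (ℕ.+-identityʳ m) ⟩
      ℚ.- (fromℕ (m ℕ.+ m) ℚ.* ½)           ≡⟨ cong (λ x → ℚ.- (x ℚ.* ½)) (fromℕ-+ m m) ⟩
      ℚ.- ((fromℕ m ℚ.+ fromℕ m) ℚ.* ½)     ≡⟨ halve (fromℕ m) ⟩
      ℚ.- fromℕ m                           ≡⟨ cong ℚ.-_ (sym (ι[+n]≡fromℕ m)) ⟩
      ℚ.- ι (+ m)                           ≡⟨ sym (ι-neg (+ m)) ⟩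
      ι (ℤ.- + m)                           ∎
      where
      halve : ∀ a → ℚ.- ((a ℚ.+ a) ℚ.* ½) ≡ ℚ.- a
      halve = solve 1 (λ a → :- ((a :+ a) :* con ½) := :- a) refl

  𝔅[2n]≡∑ : ∀ n → 𝔅 (2 ℕ.* n) ≡ ∑ (suc (2 ℕ.* n)) (λ m → ι (signedΔ n m) ℚ.* ((+ 1) /ℕ suc (2 ℕ.* m)))
  𝔅[2n]≡∑ n = begin
    ι (+ ((2 ℕ.* n) !)) ℚ.* sumTo (suc (2 ℕ.* n)) f           ≡⟨ cong (ι (+ ((2 ℕ.* n) !)) ℚ.*_) (sumTo≡∑ (suc (2 ℕ.* n)) f) ⟩
    ι (+ ((2 ℕ.* n) !)) ℚ.* ∑ (suc (2 ℕ.* n)) f               ≡⟨ *-distribˡ-∑ (suc (2 ℕ.* n)) (ι (+ ((2 ℕ.* n) !))) f ⟩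
    ∑ (suc (2 ℕ.* n)) (λ m → ι (+ ((2 ℕ.* n) !)) ℚ.* f m)     ≡⟨ ∑-cong (suc (2 ℕ.* n)) term ⟩
    ∑ (suc (2 ℕ.* n)) (λ m → ι (signedΔ n m) ℚ.* ((+ 1) /ℕ suc (2 ℕ.* m))) ∎
    where
    open ≡-Reasoning
    f : ℕ → ℚ
    f m = (twoSinHalf ^ˢ (2 ℕ.* m)) (2 ℕ.* n) ℚ.* ((+ 1) /ℕ suc (2 ℕ.* m))
    term : ∀ m → ι (+ ((2 ℕ.* n) !)) ℚ.* f m ≡ ι (signedΔ n m) ℚ.* ((+ 1) /ℕ suc (2 ℕ.* m))
    term m = trans (sym (ℚ.*-assoc (ι (+ ((2 ℕ.* n) !))) _ _)) (cong (ℚ._* ((+ 1) /ℕ suc (2 ℕ.* m))) (egf-twoSinHalf^[2m] n m))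

  primeSum≡∑ : ∀ n → 0 < n → primeSum n ≡ ∑ (suc (2 ℕ.* n)) (λ m → primeTerm n (suc (2 ℕ.* m)))
  primeSum≡∑ n 0<n = begin
    sumTo (2 ℕ.* n ℕ.+ 2) (primeTerm n)
      ≡⟨ sumTo≡∑ (2 ℕ.* n ℕ.+ 2) (primeTerm n) ⟩
    ∑ (2 ℕ.* n ℕ.+ 2) (primeTerm n)
      ≡⟨ cong (λ k → ∑ k (primeTerm n)) (trans (ℕ.+-comm (2 ℕ.* n) 2) (sym (ℕ.*-suc 2 n))) ⟩
    ∑ (2 ℕ.* suc n) (primeTerm n)
      ≡⟨ ∑-pairs (suc n) (primeTerm n) ⟩
    ∑ (suc n) (λ i → primeTerm n (2 ℕ.* i) ℚ.+ primeTerm n (suc (2 ℕ.* i)))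
      ≡⟨ ∑-cong (suc n) (λ i → trans (cong (ℚ._+ primeTerm n (suc (2 ℕ.* i))) (primeTerm-even n i)) (ℚ.+-identityˡ _)) ⟩
    ∑ (suc n) (λ i → primeTerm n (suc (2 ℕ.* i)))
      ≡⟨ sym (∑-extend (suc n) n _ large-vanish) ⟩
    ∑ (suc n ℕ.+ n) (λ i → primeTerm n (suc (2 ℕ.* i)))
      ≡⟨ cong (λ k → ∑ (suc (n ℕ.+ k)) (λ i → primeTerm n (suc (2 ℕ.* i)))) (sym (ℕ.+-identityʳ n)) ⟩
    ∑ (suc (2 ℕ.* n)) (λ m → primeTerm n (suc (2 ℕ.* m))) ∎
    where
    open ≡-Reasoning
    large-vanish : ∀ i → suc n ≤ i → primeTerm n (suc (2 ℕ.* i)) ≡ 0ℚ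
    large-vanish i n<i = primeTerm-∤ n (suc (2 ℕ.* i))
      (λ 2i∣2n → ℕ.<⇒≱ (ℕ.*-monoʳ-< 2 n<i) (ℕ.∣⇒≤ {{ℕ.>-nonZero (ℕ.*-monoʳ-< 2 0<n)}} 2i∣2n))

  𝔅[2n]+primeSum≡∑ : ∀ n → 0 < n → 𝔅 (2 ℕ.* n) ℚ.+ primeSum n
                     ≡ ∑ (suc (2 ℕ.* n)) (λ m → ι (signedΔ n m) ℚ.* ((+ 1) /ℕ suc (2 ℕ.* m)) ℚ.+ primeTerm n (suc (2 ℕ.* m)))
  𝔅[2n]+primeSum≡∑ n 0<n = trans (cong₂ ℚ._+_ (𝔅[2n]≡∑ n) (primeSum≡∑ n 0<n)) (sym (∑-distrib-+ (suc (2 ℕ.* n)) _ _))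

  private
    vanishing-primeTerm : ∀ {t} z q → + suc q ∣ℤ z → t ≡ 0ℚ → IsInteger (ι z ℚ.* ((+ 1) /ℕ suc q) ℚ.+ t)
    vanishing-primeTerm z q q∣z refl = subst IsInteger (sym (ℚ.+-identityʳ _)) (IsInteger-ι*1/q z q q∣z)

  predecessor : ∀ k → Prime (suc (2 ℕ.* k)) → Σ ℕ (λ k-1 → k ≡ suc k-1)
  predecessor zero    q-prime = ⊥-elim (¬prime[1] q-prime)
  predecessor (suc k) _       = k , refl

  term-IsInteger : ∀ n m → 0 < n →
                   IsInteger (ι (signedΔ n m) ℚ.* ((+ 1) /ℕ suc (2 ℕ.* m)) ℚ.+ primeTerm n (suc (2 ℕ.* m)))
  term-IsInteger n m 0<n = by-primality (prime? (suc (2 ℕ.* m)))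
    where
    q = suc (2 ℕ.* m)
    r = (+ 1) /ℕ q
    s = ℤ-Sums.sign m ℤ.* ℤ-Sums.sign n
    open Congruence (+ q)

    composite-case : ¬ Prime q → IsInteger (ι (signedΔ n m) ℚ.* r ℚ.+ primeTerm n q)
    composite-case ¬prime = vanishing-primeTerm (signedΔ n m) (2 ℕ.* m)
      (ℤ.∣n⇒∣m*n s (OddModuli.composite∣Δ m (2 ℕ.* n) ¬prime)) (primeTerm-nonprime n q ¬prime)

    prime-case : ∀ m-1 → m ≡ suc m-1 → Prime q → Dec (2 ℕ.* m ℕ.∣ 2 ℕ.* n) → IsInteger (ι (signedΔ n m) ℚ.* r ℚ.+ primeTerm n q)
    prime-case m-1 refl q-prime (no ∤) = vanishing-primeTerm (signedΔ n m) (2 ℕ.* m)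
      (ℤ.∣n⇒∣m*n s (≈0⇒∣ (OddModuli.prime-Δ≈0 m-1 q-prime (2 ℕ.* n) ∤))) (primeTerm-∤ n q ∤)
    prime-case m-1 refl q-prime (yes ∣) = subst IsInteger (sym combine) (IsInteger-ι*1/q (signedΔ n m ℤ.+ ℤ-Sums.sign (n ∸ m)) (2 ℕ.* m) q∣sum)
      where
      m≤n : m ≤ n
      m≤n = ℕ.*-cancelˡ-≤ 2 (ℕ.∣⇒≤ {{ℕ.>-nonZero (ℕ.*-monoʳ-< 2 0<n)}} ∣)
      combine : ι (signedΔ n m) ℚ.* r ℚ.+ primeTerm n q ≡ ι (signedΔ n m ℤ.+ ℤ-Sums.sign (n ∸ m)) ℚ.* r
      combine = begin
        ι (signedΔ n m) ℚ.* r ℚ.+ primeTerm n q                    ≡⟨ cong (ι (signedΔ n m) ℚ.* r ℚ.+_) (primeTerm-∣ n m q-prime ∣) ⟩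
        ι (signedΔ n m) ℚ.* r ℚ.+ signQ (n ∸ m) ℚ.* r              ≡⟨ cong (λ t → ι (signedΔ n m) ℚ.* r ℚ.+ t ℚ.* r) (trans (signQ≡sign (n ∸ m)) (sym (ι-sign (n ∸ m)))) ⟩
        ι (signedΔ n m) ℚ.* r ℚ.+ ι (ℤ-Sums.sign (n ∸ m)) ℚ.* r    ≡⟨ sym (ℚ.*-distribʳ-+ r (ι (signedΔ n m)) _) ⟩
        (ι (signedΔ n m) ℚ.+ ι (ℤ-Sums.sign (n ∸ m))) ℚ.* r        ≡⟨ cong (ℚ._* r) (sym (ι-+ (signedΔ n m) _)) ⟩
        ι (signedΔ n m ℤ.+ ℤ-Sums.sign (n ∸ m)) ℚ.* r              ∎
        where open ≡-Reasoning
      q∣sum : + q ∣ℤ signedΔ n m ℤ.+ ℤ-Sums.sign (n ∸ m)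
      q∣sum = subst (+ q ∣ℤ_) (trans (factor (ℤ-Sums.sign m) (ℤ-Sums.sign n) _) (cong (λ z → signedΔ n m ℤ.+ z) (sym (ℤ-Sums.sign[m∸n]≡sign[m]*sign[n] m≤n))))
                (ℤ.∣n⇒∣m*n s (P∣a-b (OddModuli.prime-Δ≈-1 m-1 q-prime (2 ℕ.* n) ∣ (ℕ.*-monoʳ-< 2 0<n))))
        where
        factor : ∀ s t d → s ℤ.* t ℤ.* (d ℤ.- ℤ.- + 1) ≡ s ℤ.* t ℤ.* d ℤ.+ t ℤ.* s
        factor = solve-∀

    by-primality : Dec (Prime q) → IsInteger (ι (signedΔ n m) ℚ.* r ℚ.+ primeTerm n q)
    by-primality (no ¬prime) = composite-case ¬prime
    by-primality (yes q-prime) with predecessor m q-prime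
    ... | m-1 , m≡1+m-1 = prime-case m-1 m≡1+m-1 q-prime (2 ℕ.* m ℕ.∣? 2 ℕ.* n)

open import Data.Nat using (_>_; _*_)
open import Data.Rational using (_+_)
open import Relation.Binary.PropositionalEquality using (sym; subst)
open Integrality using (𝔅[2n]+primeSum≡∑; IsInteger-∑; term-IsInteger)

theorem14 : (n : ℕ) → n > 0 → IsInteger (𝔅 (2 * n) + primeSum n)
theorem14 n n>0 = subst IsInteger (sym (𝔅[2n]+primeSum≡∑ n n>0)) (IsInteger-∑ (suc (2 * n)) _ (λ m _ → term-IsInteger n m n>0))
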